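{- Let $\mathcal{H}\subset\mathcal{O}$ be a family with $\mathfrak{h}_2\in\mathcal{H}$. Then $N_{\mathcal{H}}\ge2|V_s(\mathfrak{h})|+2$ for every $\mathfrak{h}\in\bar{\mathcal{H}}$ whose slim subgraph is disconnected.
   Context: All graphs are finite, simple and undirected. A Hoffman graph $\mathfrak{h}=(H,\mu)$ is a graph $H$ with labeling $\mu:V(H)\to\{f,s\}$ such that every fat vertex (label $f$) has a slim neighbour (label $s$), and fat vertices are pairwise non-adjacent. $V_s,V_f$ denote slim/fat vertex sets, $N^f_{\mathfrak{h}}(x)$ fat neighbours of $x$. A Hoffman subgraph is an induced subgraph with restricted labeling; isomorphisms preserve labels; membership in families is up to isomorphism. The slim subgraph is the graph induced on $V_s$; ordinary graphs are Hoffman graphs without fat vertices, their order is their number of vertices. Sum: $\mathfrak{h}=\bigoplus_i\mathfrak{h}^i$ (Hoffman subgraphs) means (i) $V(\mathfrak{h})=\bigcup V(\mathfrak{h}^i)$; (ii) $V_s(\mathfrak{h})$ is the disjoint union of the $V_s(\mathfrak{h}^i)$; (iii) $N^f_{\mathfrak{h}^i}(x)=N^f_{\mathfrak{h}}(x)$ for $x\in V_s(\mathfrak{h}^i)$; (iv) for slim $x\in\mathfrak{h}^i$, $y\in\mathfrak{h}^j$, $i\ne j$: $|N^f_{\mathfrak{h}}(x)\cap N^f_{\mathfrak{h}}(y)|\le1$ with equality iff $x,y$ adjacent. Indecomposable: not a sum of two non-empty Hoffman subgraphs. Fat: every slim vertex has a fat neighbour. $\mathfrak{h}_2$: one slim vertex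 adjacent to two fat vertices. $\mathcal{O}$: $\mathfrak{h}_2$ together with all indecomposable fat Hoffman graphs with at least two slim vertices and exactly one fat vertex. $\bar{\mathcal{H}}=\{\mathfrak{h}_2\}\cup\{\mathfrak{h}\in\mathcal{O}:\mathfrak{h}$ is a Hoffman subgraph of an element of $\mathcal{H}\}$. $\mathfrak{g}$ is an $\mathcal{F}$-line Hoffman graph if it is a Hoffman subgraph of some sum $\mathfrak{h}$ of members of $\mathcal{F}$ (an $\mathcal{F}$-cover; strict if $V_s(\mathfrak{h})=V_s(\mathfrak{g})$); a slim $\mathcal{F}$-line graph is such a $\mathfrak{g}$ without fat vertices. Strict covers $\mathfrak{h},\mathfrak{h}'$ of $\mathfrak{g}$ are equivalent if some isomorphism $\mathfrak{h}\to\mathfrak{h}'$ restricts to the identity on $V(\mathfrak{g})$. $N_{\mathcal{H}}$ is the smallest integer $N\ge7$ such that every connected slim $\mathcal{H}$-line graph of order $N$ has exactly one strict $\bar{\mathcal{H}}$-cover up to equivalence, and $N_{\mathcal{H}}=\infty$ if no such $N$ exists. -}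

module Defs where

open import Data.Nat using (ℕ; zero; suc; _+_; _*_; _≤_)
open import Data.Fin using (Fin; zero; suc)
open import Data.Bool using (Bool; true; false; if_then_else_)
open import Data.List using (List; map; allFin)
open import Data.Nat.ListAction using (sum)
open import Data.Product using (Σ; ∃; _×_; _,_)
open import Data.Sum using (_⊎_)
open import Data.Empty using (⊥)
open import Relation.Nullary using (¬_)
open import Relation.Binary.PropositionalEquality using (_≡_; _≢_; refl)
open import Relation.Binary.Construct.Closure.ReflexiveTransitive using (Star)

data Label : Set where
  fat slim : Label

record HGraph : Set where
  field
    n      : ℕ
    adj    : Fin n → Fin n → Bool
    sym    : ∀ x y → adj x y ≡ adj y x
    irrefl : ∀ x → adj x x ≡ false
    lab    : Fin n → Label
    fatNonAdj  : ∀ x y → lab x ≡ fat → lab y ≡ fat → adj x y ≡ false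
    fatHasSlim : ∀ x → lab x ≡ fat → ∃ λ y → adj x y ≡ true × lab y ≡ slim

open HGraph public

Adj : (h : HGraph) → Fin (n h) → Fin (n h) → Set
Adj h x y = adj h x y ≡ true

IsSlim : (h : HGraph) → Fin (n h) → Set
IsSlim h x = lab h x ≡ slim

IsFatV : (h : HGraph) → Fin (n h) → Set
IsFatV h x = lab h x ≡ fat

FatNbr : (h : HGraph) → Fin (n h) → Fin (n h) → Set
FatNbr h x f = Adj h x f × IsFatV h f

record Embedding (g h : HGraph) : Set where
  field
    emb      : Fin (n g) → Fin (n h)
    inj      : ∀ a b → emb a ≡ emb b → a ≡ b
    adj-pres : ∀ a b → adj h (emb a) (emb b) ≡ adj g a b
    lab-pres : ∀ a → lab h (emb a) ≡ lab g a

open Embedding public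

IsHoffmanSubgraph : HGraph → HGraph → Set
IsHoffmanSubgraph g h = Embedding g h

Iso : HGraph → HGraph → Set
Iso g h = Σ (Embedding g h) λ e → ∀ v → ∃ λ a → emb e a ≡ v

Family : Set₁
Family = HGraph → Set

_∈ᶠ_ : HGraph → Family → Set
g ∈ᶠ F = ∃ λ h → F h × Iso g h

Sub : HGraph → Set
Sub h = Fin (n h) → Bool

-- h = ⊕_{i < k} h^i where h^i is the Hoffman subgraph induced on S i
record IsSum (h : HGraph) (k : ℕ) (S : Fin k → Sub h) : Set where
  field
    -- each S i induces a Hoffman subgraph (fat vertices keep a slim neighbour)
    hoff    : ∀ i v → (S i) v ≡ true → IsFatV h v →
              ∃ λ w → (S i) w ≡ true × Adj h v w × IsSlim h w
    cover   : ∀ v → ∃ λ i → (S i) v ≡ true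
    slimDisjoint : ∀ i j x → IsSlim h x → (S i) x ≡ true → (S j) x ≡ true → i ≡ j
    -- (iii) fat neighbourhoods of slim vertices of h^i are the same in h^i and h
    fatClosed : ∀ i x f → IsSlim h x → (S i) x ≡ true → FatNbr h x f → (S i) f ≡ true
    atMostOne : ∀ i j x y → i ≢ j → IsSlim h x → IsSlim h y →
                (S i) x ≡ true → (S j) y ≡ true →
                ∀ f f' → FatNbr h x f → FatNbr h y f →
                FatNbr h x f' → FatNbr h y f' → f ≡ f'
    oneIffAdj : ∀ i j x y → i ≢ j → IsSlim h x → IsSlim h y →
                (S i) x ≡ true → (S j) y ≡ true →
                ((∃ λ f → FatNbr h x f × FatNbr h y f) → Adj h x y) ×
                (Adj h x y → ∃ λ f → FatNbr h x f × FatNbr h y f)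

EmbedsOnto : (g h : HGraph) → Sub h → Set
EmbedsOnto g h S = Σ (Embedding g h) λ e →
  ∀ v → ((S v ≡ true) → ∃ λ a → emb e a ≡ v) × ((∃ λ a → emb e a ≡ v) → S v ≡ true)

SumOf : Family → HGraph → Set
SumOf F h = ∃ λ k → Σ (Fin k → Sub h) λ S →
  IsSum h k S × (∀ i → ∃ λ g → g ∈ᶠ F × EmbedsOnto g h (S i))

NonEmpty : (h : HGraph) → Sub h → Set
NonEmpty h S = ∃ λ v → S v ≡ true

Indecomposable : HGraph → Set
Indecomposable h = ¬ (Σ (Fin 2 → Sub h) λ S → IsSum h 2 S × (∀ i → NonEmpty h (S i)))

IsFatGraph : HGraph → Set
IsFatGraph h = ∀ x → IsSlim h x → ∃ λ f → FatNbr h x f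

-- h₂ : one slim vertex (0) adjacent to two fat vertices (1, 2)

private
  V3 : Set
  V3 = Fin 3

  adj₂ : V3 → V3 → Bool
  adj₂ zero (suc zero) = true
  adj₂ zero (suc (suc zero)) = true
  adj₂ (suc zero) zero = true
  adj₂ (suc (suc zero)) zero = true
  adj₂ _ _ = false

  lab₂ : V3 → Label
  lab₂ zero = slim
  lab₂ _ = fat

  sym₂ : ∀ x y → adj₂ x y ≡ adj₂ y x
  sym₂ zero zero = refl
  sym₂ zero (suc zero) = refl
  sym₂ zero (suc (suc zero)) = refl
  sym₂ (suc zero) zero = refl
  sym₂ (suc zero) (suc zero) = refl
  sym₂ (suc zero) (suc (suc zero)) = refl
  sym₂ (suc (suc zero)) zero = refl
  sym₂ (suc (suc zero)) (suc zero) = refl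
  sym₂ (suc (suc zero)) (suc (suc zero)) = refl

  irr₂ : ∀ x → adj₂ x x ≡ false
  irr₂ zero = refl
  irr₂ (suc zero) = refl
  irr₂ (suc (suc zero)) = refl

  fna₂ : ∀ x y → lab₂ x ≡ fat → lab₂ y ≡ fat → adj₂ x y ≡ false
  fna₂ zero _ () _
  fna₂ (suc _) zero _ ()
  fna₂ (suc zero) (suc zero) _ _ = refl
  fna₂ (suc zero) (suc (suc zero)) _ _ = refl
  fna₂ (suc (suc zero)) (suc zero) _ _ = refl
  fna₂ (suc (suc zero)) (suc (suc zero)) _ _ = refl

  fhs₂ : ∀ x → lab₂ x ≡ fat → ∃ λ y → adj₂ x y ≡ true × lab₂ y ≡ slim
  fhs₂ zero ()
  fhs₂ (suc zero) _ = zero , refl , refl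
  fhs₂ (suc (suc zero)) _ = zero , refl , refl

h₂ : HGraph
h₂ = record
  { n = 3 ; adj = adj₂ ; sym = sym₂ ; irrefl = irr₂ ; lab = lab₂
  ; fatNonAdj = fna₂ ; fatHasSlim = fhs₂ }

AtLeastTwoSlim : HGraph → Set
AtLeastTwoSlim h = ∃ λ x → ∃ λ y → x ≢ y × IsSlim h x × IsSlim h y

ExactlyOneFat : HGraph → Set
ExactlyOneFat h = ∃ λ f → IsFatV h f × (∀ f' → IsFatV h f' → f' ≡ f)

InO : Family
InO g = Iso g h₂ ⊎ (Indecomposable g × IsFatGraph g × AtLeastTwoSlim g × ExactlyOneFat g)

HBar : Family → Family
HBar H g = Iso g h₂ ⊎ (InO g × ∃ λ h → H h × IsHoffmanSubgraph g h)

NoFat : HGraph → Set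
NoFat g = ∀ x → ¬ IsFatV g x

SlimLine : Family → HGraph → Set
SlimLine F g = NoFat g × ∃ λ h → SumOf F h × IsHoffmanSubgraph g h

-- strict F-cover of g: a sum h of members of F containing g with V_s(h) = V_s(g)
record StrictCover (F : Family) (g : HGraph) : Set where
  field
    cov    : HGraph
    isSum  : SumOf F cov
    incl   : Embedding g cov
    strict : ∀ v → IsSlim cov v → ∃ λ a → emb incl a ≡ v

open StrictCover public

EquivCover : {F : Family} {g : HGraph} → StrictCover F g → StrictCover F g → Set
EquivCover c c' = Σ (Iso (cov c) (cov c')) λ φ →
  ∀ a → emb (Data.Product.proj₁ φ) (emb (incl c) a) ≡ emb (incl c') a

UniqueStrictCover : Family → HGraph → Set
UniqueStrictCover F g = Σ (StrictCover F g) λ c → ∀ c' → EquivCover c c'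

Connected : HGraph → Set
Connected g = ∀ x y → Star (Adj g) x y

SlimAdj : (h : HGraph) → Fin (n h) → Fin (n h) → Set
SlimAdj h x y = Adj h x y × IsSlim h x × IsSlim h y

SlimConnected : HGraph → Set
SlimConnected h = ∀ x y → IsSlim h x → IsSlim h y → Star (SlimAdj h) x y

isSlimB : Label → Bool
isSlimB slim = true
isSlimB fat = false

slimCount : HGraph → ℕ
slimCount h = sum (map (λ v → if isSlimB (lab h v) then 1 else 0) (allFin (n h)))

UniqueCoverProp : Family → ℕ → Set
UniqueCoverProp H N = ∀ g → SlimLine H g → Connected g → n g ≡ N →
  UniqueStrictCover (HBar H) g

-- "N_H ≥ k" (N_H = least N ≥ 7 with the property, ∞ if none)
NH≥ : Family → ℕ → Set
NH≥ H k = ∀ N → 7 ≤ N → UniqueCoverProp H N → k ≤ N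

module Submission where

-- Proposition 5.2: if H ⊆ O contains h₂ and h ∈ H̄ has a disconnected slim graph, then
-- N_H ≥ 2|V_s(h)| + 2.  Such an h is not h₂, so it lies in O: its one fat vertex is adjacent to
-- all slim vertices, and h is an induced subgraph of some h' ∈ H of the same shape.  A cut splits
-- its slim vertices into sides C and D with no edges between them.  For 7 ≤ N ≤ 2|V_s(h)| + 1 take
-- blocks C₁, C₂ ⊆ C and D₁, D₂ ⊆ D with |C₁| + |D₁| + |C₂| + |D₂| + 1 = N; let g be their disjoint
-- union plus an apex adjacent to everything.  g is a connected slim H-line graph (it lies in the
-- join of two copies of h' with h₂) with two strict H̄-covers: fat vertices on C₁ ∪ D₁ and C₂ ∪ D₂,
-- or on C₁ ∪ D₂ and C₂ ∪ D₁.  Each such piece lies in O and in h', hence in H̄.  The first vertices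
-- of C₁ and D₁ share a fat neighbour in one cover only, so the covers are inequivalent.

open import Defs
open import Data.Nat using (ℕ; zero; suc; _+_; _*_; _∸_; _≤_; z≤n; s≤s; _≤?_)
open import Data.Nat.Properties
  using (≤-refl; ≤-trans; ≤-pred; <⇒≤; ≰⇒>; <-irrefl; m≤m+n; m≤n⇒m≤1+n; +-suc; +-identityʳ;
         m+[n∸m]≡n; m≤n+o⇒m∸n≤o)
open import Data.Nat.Tactic.RingSolver using (solve-∀)
open import Data.Nat.ListAction using (sum)
open import Data.List using (tabulate)
open import Data.List.Properties using (map-tabulate)
open import Function using (_∘_)
open import Data.Fin using (Fin; zero; suc; _≟_; inject≤)
open import Data.Fin.Properties using (+↔⊎; 1↔⊤; suc-injective; inject≤-injective)
open import Data.Bool using (Bool; true; false; _∧_; _∨_; not; if_then_else_)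
open import Data.Unit using (⊤; tt)
open import Data.Product using (∃; _×_; _,_; proj₁; proj₂)
open import Data.Sum using (_⊎_; inj₁; inj₂; [_,_]′)
import Data.Sum as Sum
open import Data.Sum.Properties using (inj₁-injective; inj₂-injective)
open import Data.Sum.Function.Propositional using (_⊎-↔_)
open import Data.Empty using (⊥; ⊥-elim)
open import Function.Bundles using (_↔_; Inverse)
open import Function.Properties.Inverse using (↔-refl; ↔-trans)
open import Relation.Nullary using (¬_; yes; no; does)
open import Relation.Binary.PropositionalEquality
  using (_≡_; _≢_; refl; trans; cong; cong₂; subst; subst₂; module ≡-Reasoning)
import Relation.Binary.PropositionalEquality as ≡
open import Relation.Binary.Construct.Closure.ReflexiveTransitive using (Star; ε; _◅_; _◅◅_; reverse)

record FinType : Set₁ where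
  field
    Carrier   : Set
    size      : ℕ
    numbering : Fin size ↔ Carrier

  decode : Fin size → Carrier
  decode = Inverse.to numbering

  encode : Carrier → Fin size
  encode = Inverse.from numbering

  decode-encode : ∀ v → decode (encode v) ≡ v
  decode-encode = Inverse.strictlyInverseˡ numbering

  encode-decode : ∀ x → encode (decode x) ≡ x
  encode-decode = Inverse.strictlyInverseʳ numbering

  decode-injective : ∀ x y → decode x ≡ decode y → x ≡ y
  decode-injective x y e = trans (≡.sym (encode-decode x)) (trans (cong encode e) (encode-decode y))

open FinType public

atEncode : (V : FinType) (P : Carrier V → Set) {v : Carrier V} → P v → P (decode V (encode V v))
atEncode V P {v} = subst P (≡.sym (decode-encode V v))

finite : ℕ → FinType
finite k = record { Carrier = Fin k ; size = k ; numbering = ↔-refl }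

point : FinType
point = record { Carrier = ⊤ ; size = 1 ; numbering = 1↔⊤ }

_⊎ᶠ_ : FinType → FinType → FinType
A ⊎ᶠ B = record
  { Carrier = Carrier A ⊎ Carrier B
  ; size = size A + size B
  ; numbering = ↔-trans +↔⊎ (numbering A ⊎-↔ numbering B) }

record HGraphOn (V : Set) : Set where
  field
    edge        : V → V → Bool
    edge-sym    : ∀ u v → edge u v ≡ edge v u
    edge-irrefl : ∀ v → edge v v ≡ false
    label       : V → Label
    fat-indep   : ∀ u v → label u ≡ fat → label v ≡ fat → edge u v ≡ false
    fat-slimNbr : ∀ u → label u ≡ fat → ∃ λ v → edge u v ≡ true × label v ≡ slim

open HGraphOn public

realise : (V : FinType) → HGraphOn (Carrier V) → HGraph
realise V X = record
  { n = size V
  ; adj = λ x y → edge X (decode V x) (decode V y)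
  ; sym = λ x y → edge-sym X (decode V x) (decode V y)
  ; irrefl = λ x → edge-irrefl X (decode V x)
  ; lab = λ x → label X (decode V x)
  ; fatNonAdj = λ x y → fat-indep X (decode V x) (decode V y)
  ; fatHasSlim = slimNbr }
  where
  slimNbr : ∀ x → label X (decode V x) ≡ fat →
            ∃ λ y → edge X (decode V x) (decode V y) ≡ true × label X (decode V y) ≡ slim
  slimNbr x fx with fat-slimNbr X (decode V x) fx
  ... | w , xw , slim-w rewrite ≡.sym (decode-encode V w) = encode V w , xw , slim-w

onFin : (h : HGraph) → HGraphOn (Fin (n h))
onFin h = record
  { edge = adj h ; edge-sym = HGraph.sym h ; edge-irrefl = irrefl h ; label = lab h
  ; fat-indep = fatNonAdj h ; fat-slimNbr = fatHasSlim h }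

FatNbrOn : {V : Set} → HGraphOn V → V → V → Set
FatNbrOn X u w = edge X u w ≡ true × label X w ≡ fat

SharedFat : {V : Set} → HGraphOn V → V → V → Set
SharedFat X u v = ∃ λ w → FatNbrOn X u w × FatNbrOn X v w

record _⇒_ {V W : Set} (X : HGraphOn V) (Y : HGraphOn W) : Set where
  field
    vmap       : V → W
    injective  : ∀ u v → vmap u ≡ vmap v → u ≡ v
    edge-pres  : ∀ u v → edge Y (vmap u) (vmap v) ≡ edge X u v
    label-pres : ∀ v → label Y (vmap v) ≡ label X v

open _⇒_ public

infixr 9 _∘ᵉ_

_∘ᵉ_ : {U V W : Set} {X : HGraphOn U} {Y : HGraphOn V} {Z : HGraphOn W} →
       Y ⇒ Z → X ⇒ Y → X ⇒ Z
e₂ ∘ᵉ e₁ = record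
  { vmap = λ u → vmap e₂ (vmap e₁ u)
  ; injective = λ u v p → injective e₁ u v (injective e₂ _ _ p)
  ; edge-pres = λ u v → trans (edge-pres e₂ _ _) (edge-pres e₁ u v)
  ; label-pres = λ u → trans (label-pres e₂ _) (label-pres e₁ u) }

fromEmbedding : {g h : HGraph} → Embedding g h → onFin g ⇒ onFin h
fromEmbedding e = record
  { vmap = emb e ; injective = inj e ; edge-pres = adj-pres e ; label-pres = lab-pres e }

OntoPart : {V W : Set} {X : HGraphOn V} {Y : HGraphOn W} → X ⇒ Y → (W → Bool) → Set
OntoPart {V} e S = ∀ w → (S w ≡ true → ∃ λ (v : V) → vmap e v ≡ w) ×
                         ((∃ λ (v : V) → vmap e v ≡ w) → S w ≡ true)

SlimOnto : {V W : Set} {X : HGraphOn V} {Y : HGraphOn W} → X ⇒ Y → Set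
SlimOnto {V} {Y = Y} e = ∀ w → label Y w ≡ slim → ∃ λ (v : V) → vmap e v ≡ w

∘ᵉ-slimOnto : {U V W : Set} {X : HGraphOn U} {Y : HGraphOn V} {Z : HGraphOn W} →
              (e₂ : Y ⇒ Z) (e₁ : X ⇒ Y) → SlimOnto e₂ → SlimOnto e₁ → SlimOnto (e₂ ∘ᵉ e₁)
∘ᵉ-slimOnto e₂ e₁ onto₂ onto₁ w slim-w with onto₂ w slim-w
... | v , refl with onto₁ v (trans (≡.sym (label-pres e₂ v)) slim-w)
... | u , refl = u , refl

module _ {W : FinType} {Y : HGraphOn (Carrier W)} where

  realise-sharedFat : ∀ x y → SharedFat Y (decode W x) (decode W y) →
                      ∃ λ f → FatNbr (realise W Y) x f × FatNbr (realise W Y) y f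
  realise-sharedFat x y (w , xw , yw) rewrite ≡.sym (decode-encode W w) = encode W w , xw , yw

  realise-sharedFat⁻ : ∀ x y → (∃ λ f → FatNbr (realise W Y) x f × FatNbr (realise W Y) y f) →
                       SharedFat Y (decode W x) (decode W y)
  realise-sharedFat⁻ x y (f , xf , yf) = decode W f , xf , yf

module Realise {V W : FinType} {X : HGraphOn (Carrier V)} {Y : HGraphOn (Carrier W)}
               (e : X ⇒ Y) where

  embedding : Embedding (realise V X) (realise W Y)
  embedding = record
    { emb = λ x → encode W (vmap e (decode V x))
    ; inj = λ x y p → decode-injective V x y
              (injective e _ _ (trans (≡.sym (decode-encode W _)) (trans (cong (decode W) p) (decode-encode W _))))
    ; adj-pres = λ x y → trans (cong₂ (edge Y) (decode-encode W _) (decode-encode W _)) (edge-pres e _ _)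
    ; lab-pres = λ x → trans (cong (label Y) (decode-encode W _)) (label-pres e _) }

  decode-emb : ∀ v → decode W (emb embedding (encode V v)) ≡ vmap e v
  decode-emb v = trans (decode-encode W _) (cong (vmap e) (decode-encode V v))

  preimage : ∀ x v → vmap e v ≡ decode W x → ∃ λ a → emb embedding a ≡ x
  preimage x v p = encode V v , trans (cong (encode W) (trans (cong (vmap e) (decode-encode V v)) p))
                                      (encode-decode W x)

  onto : (S : Carrier W → Bool) → OntoPart e S →
         EmbedsOnto (realise V X) (realise W Y) (λ x → S (decode W x))
  onto S part = embedding , λ x → into x , back x
    where
    into : ∀ x → S (decode W x) ≡ true → ∃ λ a → emb embedding a ≡ x
    into x s with proj₁ (part (decode W x)) s
    ... | v , p = preimage x v p
    back : ∀ x → (∃ λ a → emb embedding a ≡ x) → S (decode W x) ≡ true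
    back x (a , refl) = subst (λ w → S w ≡ true) (≡.sym (decode-encode W _))
                              (proj₂ (part _) (decode V a , refl))

  slimCovered : SlimOnto e → ∀ x → IsSlim (realise W Y) x → ∃ λ a → emb embedding a ≡ x
  slimCovered so x slim-x with so (decode W x) slim-x
  ... | v , p = preimage x v p


record IsSumOn {V : Set} (X : HGraphOn V) (k : ℕ) (S : Fin k → V → Bool) : Set where
  field
    partHasSlim  : ∀ i u → S i u ≡ true → label X u ≡ fat →
                   ∃ λ w → S i w ≡ true × edge X u w ≡ true × label X w ≡ slim
    covering     : ∀ u → ∃ λ i → S i u ≡ true
    slimDisjoint : ∀ i j u → label X u ≡ slim → S i u ≡ true → S j u ≡ true → i ≡ j
    fatClosed    : ∀ i u w → label X u ≡ slim → S i u ≡ true → FatNbrOn X u w → S i w ≡ true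
    atMostOne    : ∀ i j u v → i ≢ j → label X u ≡ slim → label X v ≡ slim →
                   S i u ≡ true → S j v ≡ true → ∀ w w' →
                   FatNbrOn X u w → FatNbrOn X v w → FatNbrOn X u w' → FatNbrOn X v w' → w ≡ w'
    sharedIsAdj  : ∀ i j u v → i ≢ j → label X u ≡ slim → label X v ≡ slim →
                   S i u ≡ true → S j v ≡ true → SharedFat X u v → edge X u v ≡ true
    adjIsShared  : ∀ i j u v → i ≢ j → label X u ≡ slim → label X v ≡ slim →
                   S i u ≡ true → S j v ≡ true → edge X u v ≡ true → SharedFat X u v

realiseSum : {V : FinType} {X : HGraphOn (Carrier V)} {k : ℕ} {S : Fin k → Carrier V → Bool} →
             IsSumOn X k S → IsSum (realise V X) k (λ i x → S i (decode V x))
realiseSum {V} {X} {k} {S} I = record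
  { hoff = λ i x sx fx → let (w , sw , xw , slim-w) = partHasSlim i (decode V x) sx fx in
      encode V w , atEncode V (λ u → S i u ≡ true) sw , atEncode V (λ u → edge X (decode V x) u ≡ true) xw
                 , atEncode V (λ u → label X u ≡ slim) slim-w
  ; cover = λ x → covering (decode V x)
  ; slimDisjoint = λ i j x → slimDisjoint i j (decode V x)
  ; fatClosed = λ i x f → fatClosed i (decode V x) (decode V f)
  ; atMostOne = λ i j x y i≢j sx sy ix jy f f' xf yf xf' yf' → decode-injective V f f'
      (atMostOne i j (decode V x) (decode V y) i≢j sx sy ix jy _ _ xf yf xf' yf')
  ; oneIffAdj = λ i j x y i≢j sx sy ix jy →
      (λ shared → sharedIsAdj i j _ _ i≢j sx sy ix jy (realise-sharedFat⁻ {V} {X} x y shared))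
    , (λ xy → realise-sharedFat {V} {X} x y (adjIsShared i j _ _ i≢j sx sy ix jy xy)) }
  where
  open IsSumOn I

slim≢fat : slim ≢ fat
slim≢fat ()

_⊔_ : {A B : Set} → HGraphOn A → HGraphOn B → HGraphOn (A ⊎ B)
_⊔_ {A} {B} X Y = record
  { edge = E ; edge-sym = E-sym ; edge-irrefl = E-irrefl ; label = [ label X , label Y ]′
  ; fat-indep = indep ; fat-slimNbr = slimNbr }
  where
  E : A ⊎ B → A ⊎ B → Bool
  E (inj₁ a) (inj₁ a') = edge X a a'
  E (inj₂ b) (inj₂ b') = edge Y b b'
  E _ _ = false
  E-sym : ∀ u v → E u v ≡ E v u
  E-sym (inj₁ a) (inj₁ a') = edge-sym X a a'
  E-sym (inj₁ _) (inj₂ _) = refl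
  E-sym (inj₂ _) (inj₁ _) = refl
  E-sym (inj₂ b) (inj₂ b') = edge-sym Y b b'
  E-irrefl : ∀ u → E u u ≡ false
  E-irrefl (inj₁ a) = edge-irrefl X a
  E-irrefl (inj₂ b) = edge-irrefl Y b
  indep : ∀ u v → [ label X , label Y ]′ u ≡ fat → [ label X , label Y ]′ v ≡ fat → E u v ≡ false
  indep (inj₁ a) (inj₁ a') = fat-indep X a a'
  indep (inj₁ _) (inj₂ _) _ _ = refl
  indep (inj₂ _) (inj₁ _) _ _ = refl
  indep (inj₂ b) (inj₂ b') = fat-indep Y b b'
  slimNbr : ∀ u → [ label X , label Y ]′ u ≡ fat →
            ∃ λ v → E u v ≡ true × [ label X , label Y ]′ v ≡ slim
  slimNbr (inj₁ a) fat-a = let (a' , aa' , slim-a') = fat-slimNbr X a fat-a in inj₁ a' , aa' , slim-a'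
  slimNbr (inj₂ b) fat-b = let (b' , bb' , slim-b') = fat-slimNbr Y b fat-b in inj₂ b' , bb' , slim-b'

coneEdge : {A : Set} → (A → A → Bool) → A ⊎ ⊤ → A ⊎ ⊤ → Bool
coneEdge E (inj₁ a) (inj₁ a') = E a a'
coneEdge E (inj₂ _) (inj₂ _) = false
coneEdge E _ _ = true

coneEdge-sym : {A : Set} (E : A → A → Bool) → (∀ a a' → E a a' ≡ E a' a) →
               ∀ u v → coneEdge E u v ≡ coneEdge E v u
coneEdge-sym E E-sym (inj₁ a) (inj₁ a') = E-sym a a'
coneEdge-sym E E-sym (inj₁ _) (inj₂ _) = refl
coneEdge-sym E E-sym (inj₂ _) (inj₁ _) = refl
coneEdge-sym E E-sym (inj₂ _) (inj₂ _) = refl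

coneEdge-irrefl : {A : Set} (E : A → A → Bool) → (∀ a → E a a ≡ false) →
                  ∀ u → coneEdge E u u ≡ false
coneEdge-irrefl E E-irrefl (inj₁ a) = E-irrefl a
coneEdge-irrefl E E-irrefl (inj₂ _) = refl

apex : {A : Set} → HGraphOn A → HGraphOn (A ⊎ ⊤)
apex {A} X = record
  { edge = coneEdge (edge X) ; edge-sym = coneEdge-sym (edge X) (edge-sym X)
  ; edge-irrefl = coneEdge-irrefl (edge X) (edge-irrefl X) ; label = L
  ; fat-indep = indep ; fat-slimNbr = slimNbr }
  where
  L : A ⊎ ⊤ → Label
  L = [ label X , (λ _ → slim) ]′
  indep : ∀ u v → L u ≡ fat → L v ≡ fat → coneEdge (edge X) u v ≡ false
  indep (inj₁ a) (inj₁ a') = fat-indep X a a'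
  indep (inj₁ _) (inj₂ _) _ ()
  indep (inj₂ _) _ ()
  slimNbr : ∀ u → L u ≡ fat → ∃ λ v → coneEdge (edge X) u v ≡ true × L v ≡ slim
  slimNbr (inj₁ _) _ = inj₂ tt , refl , refl
  slimNbr (inj₂ _) ()

AllSlim : {A : Set} → HGraphOn A → Set
AllSlim {A} X = ∀ (a : A) → label X a ≡ slim

⊔-allSlim : {A B : Set} {X : HGraphOn A} {Y : HGraphOn B} → AllSlim X → AllSlim Y → AllSlim (X ⊔ Y)
⊔-allSlim slimX slimY (inj₁ a) = slimX a
⊔-allSlim slimX slimY (inj₂ b) = slimY b

fatCone : {A : Set} (X : HGraphOn A) → AllSlim X → A → HGraphOn (A ⊎ ⊤)
fatCone {A} X allSlim a₀ = record
  { edge = coneEdge (edge X) ; edge-sym = coneEdge-sym (edge X) (edge-sym X)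
  ; edge-irrefl = coneEdge-irrefl (edge X) (edge-irrefl X) ; label = L
  ; fat-indep = indep ; fat-slimNbr = slimNbr }
  where
  L : A ⊎ ⊤ → Label
  L = [ label X , (λ _ → fat) ]′
  indep : ∀ u v → L u ≡ fat → L v ≡ fat → coneEdge (edge X) u v ≡ false
  indep (inj₁ a) _ fat-a = ⊥-elim (slim≢fat (trans (≡.sym (allSlim a)) fat-a))
  indep (inj₂ _) (inj₁ a) _ fat-a = ⊥-elim (slim≢fat (trans (≡.sym (allSlim a)) fat-a))
  indep (inj₂ _) (inj₂ _) _ _ = refl
  slimNbr : ∀ u → L u ≡ fat → ∃ λ v → coneEdge (edge X) u v ≡ true × L v ≡ slim
  slimNbr (inj₁ a) fat-a = ⊥-elim (slim≢fat (trans (≡.sym (allSlim a)) fat-a))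
  slimNbr (inj₂ _) _ = inj₁ a₀ , refl , allSlim a₀

slimBlock : {A W : Set} (Y : HGraphOn W) (φ : A → W) → (∀ a → label Y (φ a) ≡ slim) → HGraphOn A
slimBlock Y φ slim-φ = record
  { edge = λ a a' → edge Y (φ a) (φ a') ; edge-sym = λ a a' → edge-sym Y (φ a) (φ a')
  ; edge-irrefl = λ a → edge-irrefl Y (φ a) ; label = λ _ → slim
  ; fat-indep = λ _ _ () ; fat-slimNbr = λ _ () }

module _ {A B A' B' : Set} {X : HGraphOn A} {Y : HGraphOn B} {X' : HGraphOn A'} {Y' : HGraphOn B'} where

  ⊔-map : X ⇒ X' → Y ⇒ Y' → (X ⊔ Y) ⇒ (X' ⊔ Y')
  ⊔-map e₁ e₂ = record { vmap = Sum.map (vmap e₁) (vmap e₂) ; injective = inj' ; edge-pres = pres ; label-pres = lpres }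
    where
    inj' : ∀ u v → Sum.map (vmap e₁) (vmap e₂) u ≡ Sum.map (vmap e₁) (vmap e₂) v → u ≡ v
    inj' (inj₁ a) (inj₁ a') p = cong inj₁ (injective e₁ a a' (inj₁-injective p))
    inj' (inj₂ b) (inj₂ b') p = cong inj₂ (injective e₂ b b' (inj₂-injective p))
    inj' (inj₁ _) (inj₂ _) ()
    inj' (inj₂ _) (inj₁ _) ()
    pres : ∀ u v → edge (X' ⊔ Y') (Sum.map (vmap e₁) (vmap e₂) u) (Sum.map (vmap e₁) (vmap e₂) v) ≡ edge (X ⊔ Y) u v
    pres (inj₁ a) (inj₁ a') = edge-pres e₁ a a'
    pres (inj₁ _) (inj₂ _) = refl
    pres (inj₂ _) (inj₁ _) = refl
    pres (inj₂ b) (inj₂ b') = edge-pres e₂ b b'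
    lpres : ∀ u → label (X' ⊔ Y') (Sum.map (vmap e₁) (vmap e₂) u) ≡ label (X ⊔ Y) u
    lpres (inj₁ a) = label-pres e₁ a
    lpres (inj₂ b) = label-pres e₂ b

  ⊔-map-slimOnto : (e₁ : X ⇒ X') (e₂ : Y ⇒ Y') → SlimOnto e₁ → SlimOnto e₂ → SlimOnto (⊔-map e₁ e₂)
  ⊔-map-slimOnto e₁ e₂ onto₁ onto₂ (inj₁ w) slim-w = let (v , p) = onto₁ w slim-w in inj₁ v , cong inj₁ p
  ⊔-map-slimOnto e₁ e₂ onto₁ onto₂ (inj₂ w) slim-w = let (v , p) = onto₂ w slim-w in inj₂ v , cong inj₂ p

⊔-into : {A B W : Set} {X : HGraphOn A} {Y : HGraphOn B} {Z : HGraphOn W} →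
         (e₁ : X ⇒ Z) (e₂ : Y ⇒ Z) → (∀ a b → vmap e₁ a ≢ vmap e₂ b) →
         (∀ a b → edge Z (vmap e₁ a) (vmap e₂ b) ≡ false) → (X ⊔ Y) ⇒ Z
⊔-into {X = X} {Y} {Z} e₁ e₂ disjoint apart = record
  { vmap = [ vmap e₁ , vmap e₂ ]′ ; injective = inj' ; edge-pres = pres ; label-pres = lpres }
  where
  inj' : ∀ u v → [ vmap e₁ , vmap e₂ ]′ u ≡ [ vmap e₁ , vmap e₂ ]′ v → u ≡ v
  inj' (inj₁ a) (inj₁ a') p = cong inj₁ (injective e₁ a a' p)
  inj' (inj₂ b) (inj₂ b') p = cong inj₂ (injective e₂ b b' p)
  inj' (inj₁ a) (inj₂ b) p = ⊥-elim (disjoint a b p)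
  inj' (inj₂ b) (inj₁ a) p = ⊥-elim (disjoint a b (≡.sym p))
  pres : ∀ u v → edge Z ([ vmap e₁ , vmap e₂ ]′ u) ([ vmap e₁ , vmap e₂ ]′ v) ≡ edge (X ⊔ Y) u v
  pres (inj₁ a) (inj₁ a') = edge-pres e₁ a a'
  pres (inj₁ a) (inj₂ b) = apart a b
  pres (inj₂ b) (inj₁ a) = trans (edge-sym Z _ _) (apart a b)
  pres (inj₂ b) (inj₂ b') = edge-pres e₂ b b'
  lpres : ∀ u → label Z ([ vmap e₁ , vmap e₂ ]′ u) ≡ label (X ⊔ Y) u
  lpres (inj₁ a) = label-pres e₁ a
  lpres (inj₂ b) = label-pres e₂ b

module _ {A B C D : Set} {P : HGraphOn A} {Q : HGraphOn B} {R : HGraphOn C} {S : HGraphOn D} where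

  private
    swap : (A ⊎ B) ⊎ (C ⊎ D) → (A ⊎ D) ⊎ (C ⊎ B)
    swap (inj₁ (inj₁ a)) = inj₁ (inj₁ a)
    swap (inj₁ (inj₂ b)) = inj₂ (inj₂ b)
    swap (inj₂ (inj₁ c)) = inj₂ (inj₁ c)
    swap (inj₂ (inj₂ d)) = inj₁ (inj₂ d)

    unswap : (A ⊎ D) ⊎ (C ⊎ B) → (A ⊎ B) ⊎ (C ⊎ D)
    unswap (inj₁ (inj₁ a)) = inj₁ (inj₁ a)
    unswap (inj₁ (inj₂ d)) = inj₂ (inj₂ d)
    unswap (inj₂ (inj₁ c)) = inj₂ (inj₁ c)
    unswap (inj₂ (inj₂ b)) = inj₁ (inj₂ b)

    unswap-swap : ∀ u → unswap (swap u) ≡ u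
    unswap-swap (inj₁ (inj₁ _)) = refl
    unswap-swap (inj₁ (inj₂ _)) = refl
    unswap-swap (inj₂ (inj₁ _)) = refl
    unswap-swap (inj₂ (inj₂ _)) = refl

    swap-unswap : ∀ w → swap (unswap w) ≡ w
    swap-unswap (inj₁ (inj₁ _)) = refl
    swap-unswap (inj₁ (inj₂ _)) = refl
    swap-unswap (inj₂ (inj₁ _)) = refl
    swap-unswap (inj₂ (inj₂ _)) = refl

    swap-edge : ∀ u v → edge ((P ⊔ S) ⊔ (R ⊔ Q)) (swap u) (swap v) ≡ edge ((P ⊔ Q) ⊔ (R ⊔ S)) u v
    swap-edge (inj₁ (inj₁ a)) (inj₁ (inj₁ a')) = refl
    swap-edge (inj₁ (inj₂ b)) (inj₁ (inj₂ b')) = refl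
    swap-edge (inj₂ (inj₁ c)) (inj₂ (inj₁ c')) = refl
    swap-edge (inj₂ (inj₂ d)) (inj₂ (inj₂ d')) = refl
    swap-edge (inj₁ (inj₁ _)) (inj₁ (inj₂ _)) = refl
    swap-edge (inj₁ (inj₁ _)) (inj₂ (inj₁ _)) = refl
    swap-edge (inj₁ (inj₁ _)) (inj₂ (inj₂ _)) = refl
    swap-edge (inj₁ (inj₂ _)) (inj₁ (inj₁ _)) = refl
    swap-edge (inj₁ (inj₂ _)) (inj₂ (inj₁ _)) = refl
    swap-edge (inj₁ (inj₂ _)) (inj₂ (inj₂ _)) = refl
    swap-edge (inj₂ (inj₁ _)) (inj₁ (inj₁ _)) = refl
    swap-edge (inj₂ (inj₁ _)) (inj₁ (inj₂ _)) = refl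
    swap-edge (inj₂ (inj₁ _)) (inj₂ (inj₂ _)) = refl
    swap-edge (inj₂ (inj₂ _)) (inj₁ (inj₁ _)) = refl
    swap-edge (inj₂ (inj₂ _)) (inj₁ (inj₂ _)) = refl
    swap-edge (inj₂ (inj₂ _)) (inj₂ (inj₁ _)) = refl

    swap-label : ∀ u → label ((P ⊔ S) ⊔ (R ⊔ Q)) (swap u) ≡ label ((P ⊔ Q) ⊔ (R ⊔ S)) u
    swap-label (inj₁ (inj₁ _)) = refl
    swap-label (inj₁ (inj₂ _)) = refl
    swap-label (inj₂ (inj₁ _)) = refl
    swap-label (inj₂ (inj₂ _)) = refl

  ⊔-interchange : ((P ⊔ Q) ⊔ (R ⊔ S)) ⇒ ((P ⊔ S) ⊔ (R ⊔ Q))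
  ⊔-interchange = record
    { vmap = swap
    ; injective = λ u v p → trans (≡.sym (unswap-swap u)) (trans (cong unswap p) (unswap-swap v))
    ; edge-pres = swap-edge ; label-pres = swap-label }

  ⊔-interchange-slimOnto : SlimOnto ⊔-interchange
  ⊔-interchange-slimOnto w _ = unswap w , swap-unswap w

module _ {A B : Set} {X : HGraphOn A} {Y : HGraphOn B} where

  apex-map : X ⇒ Y → apex X ⇒ apex Y
  apex-map e = record { vmap = Sum.map (vmap e) (λ t → t) ; injective = inj' ; edge-pres = pres ; label-pres = lpres }
    where
    inj' : ∀ u v → Sum.map (vmap e) (λ t → t) u ≡ Sum.map (vmap e) (λ t → t) v → u ≡ v
    inj' (inj₁ a) (inj₁ a') p = cong inj₁ (injective e a a' (inj₁-injective p))
    inj' (inj₂ tt) (inj₂ tt) _ = refl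
    inj' (inj₁ _) (inj₂ _) ()
    inj' (inj₂ _) (inj₁ _) ()
    pres : ∀ u v → edge (apex Y) (Sum.map (vmap e) (λ t → t) u) (Sum.map (vmap e) (λ t → t) v) ≡ edge (apex X) u v
    pres (inj₁ a) (inj₁ a') = edge-pres e a a'
    pres (inj₁ _) (inj₂ _) = refl
    pres (inj₂ _) (inj₁ _) = refl
    pres (inj₂ _) (inj₂ _) = refl
    lpres : ∀ u → label (apex Y) (Sum.map (vmap e) (λ t → t) u) ≡ label (apex X) u
    lpres (inj₁ a) = label-pres e a
    lpres (inj₂ _) = refl

  apex-map-slimOnto : (e : X ⇒ Y) → SlimOnto e → SlimOnto (apex-map e)
  apex-map-slimOnto e onto (inj₁ w) slim-w = let (v , p) = onto w slim-w in inj₁ v , cong inj₁ p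
  apex-map-slimOnto e onto (inj₂ tt) _ = inj₂ tt , refl

module _ {A : Set} {X : HGraphOn A} {allSlim : AllSlim X} {a₀ : A} where

  cone-incl : X ⇒ fatCone X allSlim a₀
  cone-incl = record
    { vmap = inj₁ ; injective = λ _ _ → inj₁-injective ; edge-pres = λ _ _ → refl ; label-pres = λ _ → refl }

  cone-incl-slimOnto : SlimOnto cone-incl
  cone-incl-slimOnto (inj₁ a) _ = a , refl
  cone-incl-slimOnto (inj₂ _) ()

  cone-into : {W : Set} {Z : HGraphOn W} (e : X ⇒ Z) (z : W) → label Z z ≡ fat →
              (∀ a → edge Z (vmap e a) z ≡ true) → fatCone X allSlim a₀ ⇒ Z
  cone-into {Z = Z} e z fat-z adj-z = record
    { vmap = [ vmap e , (λ _ → z) ]′ ; injective = inj' ; edge-pres = pres ; label-pres = lpres }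
    where
    image≢z : ∀ a → vmap e a ≢ z
    image≢z a p = slim≢fat (trans (≡.sym (trans (label-pres e a) (allSlim a))) (trans (cong (label Z) p) fat-z))
    inj' : ∀ u v → [ vmap e , (λ _ → z) ]′ u ≡ [ vmap e , (λ _ → z) ]′ v → u ≡ v
    inj' (inj₁ a) (inj₁ a') p = cong inj₁ (injective e a a' p)
    inj' (inj₁ a) (inj₂ _) p = ⊥-elim (image≢z a p)
    inj' (inj₂ _) (inj₁ a) p = ⊥-elim (image≢z a (≡.sym p))
    inj' (inj₂ tt) (inj₂ tt) _ = refl
    pres : ∀ u v → edge Z ([ vmap e , (λ _ → z) ]′ u) ([ vmap e , (λ _ → z) ]′ v) ≡ edge (fatCone X allSlim a₀) u v
    pres (inj₁ a) (inj₁ a') = edge-pres e a a'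
    pres (inj₁ a) (inj₂ _) = adj-z a
    pres (inj₂ _) (inj₁ a) = trans (edge-sym Z z _) (adj-z a)
    pres (inj₂ _) (inj₂ _) = edge-irrefl Z z
    lpres : ∀ u → label Z ([ vmap e , (λ _ → z) ]′ u) ≡ label (fatCone X allSlim a₀) u
    lpres (inj₁ a) = label-pres e a
    lpres (inj₂ _) = fat-z

block-into : {A W : Set} (Y : HGraphOn W) (φ : A → W) (slim-φ : ∀ a → label Y (φ a) ≡ slim) →
             (∀ a a' → φ a ≡ φ a' → a ≡ a') → slimBlock Y φ slim-φ ⇒ Y
block-into Y φ slim-φ φ-inj = record
  { vmap = φ ; injective = φ-inj ; edge-pres = λ _ _ → refl ; label-pres = slim-φ }

record OneFat {A : Set} (X : HGraphOn A) : Set where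
  field
    pole        : A
    pole-fat    : label X pole ≡ fat
    pole-unique : ∀ a → label X a ≡ fat → a ≡ pole
    pole-adj    : ∀ a → label X a ≡ slim → edge X a pole ≡ true

open OneFat

fatCone-oneFat : {A : Set} (X : HGraphOn A) (allSlim : AllSlim X) (a₀ : A) → OneFat (fatCone X allSlim a₀)
fatCone-oneFat X allSlim a₀ = record
  { pole = inj₂ tt ; pole-fat = refl ; pole-unique = unique ; pole-adj = adjacent }
  where
  unique : ∀ u → label (fatCone X allSlim a₀) u ≡ fat → u ≡ inj₂ tt
  unique (inj₁ a) fat-a = ⊥-elim (slim≢fat (trans (≡.sym (allSlim a)) fat-a))
  unique (inj₂ tt) _ = refl
  adjacent : ∀ u → label (fatCone X allSlim a₀) u ≡ slim → edge (fatCone X allSlim a₀) u (inj₂ tt) ≡ true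
  adjacent (inj₁ _) _ = refl
  adjacent (inj₂ _) ()

∧-true : ∀ {a b} → a ≡ true → b ≡ true → (a ∧ b) ≡ true
∧-true refl refl = refl

∧-trueˡ : ∀ {a b} → (a ∧ b) ≡ true → a ≡ true
∧-trueˡ {true} _ = refl

∧-trueʳ : ∀ {a b} → (a ∧ b) ≡ true → b ≡ true
∧-trueʳ {true} p = p

∨-trueˡ : ∀ {a b} → a ≡ true → (a ∨ b) ≡ true
∨-trueˡ refl = refl

∨-trueʳ : ∀ {a b} → b ≡ true → (a ∨ b) ≡ true
∨-trueʳ {true} _ = refl
∨-trueʳ {false} p = p

∨-true : ∀ {a b} → (a ∨ b) ≡ true → a ≡ true ⊎ b ≡ true
∨-true {true} _ = inj₁ refl
∨-true {false} p = inj₂ p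

not-true : ∀ {a} → not a ≡ true → a ≡ false
not-true {false} _ = refl

true≢false : ∀ {a} → a ≡ true → a ≢ false
true≢false refl ()

isFatB : Label → Bool
isFatB fat = true
isFatB slim = false

isFatB-sound : ∀ {l} → isFatB l ≡ true → l ≡ fat
isFatB-sound {fat} _ = refl

-- The parts of the join apex (X ⊔ Y): X, Y, and the apex with the fat vertices.
joinPart : {A B : Set} → HGraphOn A → HGraphOn B → Fin 3 → (A ⊎ B) ⊎ ⊤ → Bool
joinPart X Y zero (inj₁ (inj₁ _)) = true
joinPart X Y (suc zero) (inj₁ (inj₂ _)) = true
joinPart X Y (suc (suc zero)) (inj₁ (inj₁ a)) = isFatB (label X a)
joinPart X Y (suc (suc zero)) (inj₁ (inj₂ b)) = isFatB (label Y b)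
joinPart X Y (suc (suc zero)) (inj₂ _) = true
joinPart X Y _ _ = false

-- If X and Y have exactly one fat vertex each, adjacent to all their slim vertices,
-- then apex (X ⊔ Y) is the sum of X, Y and a copy of h₂ (apex and the two poles).
module Join {A B : Set} {X : HGraphOn A} {Y : HGraphOn B} (OX : OneFat X) (OY : OneFat Y) where

  J : HGraphOn ((A ⊎ B) ⊎ ⊤)
  J = apex (X ⊔ Y)

  S : Fin 3 → (A ⊎ B) ⊎ ⊤ → Bool
  S = joinPart X Y

  data SlimView : (A ⊎ B) ⊎ ⊤ → Set where
    left  : ∀ a → label X a ≡ slim → SlimView (inj₁ (inj₁ a))
    right : ∀ b → label Y b ≡ slim → SlimView (inj₁ (inj₂ b))
    top   : SlimView (inj₂ tt)

  slimView : ∀ u → label J u ≡ slim → SlimView u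
  slimView (inj₁ (inj₁ a)) s = left a s
  slimView (inj₁ (inj₂ b)) s = right b s
  slimView (inj₂ tt) _ = top

  partOf : ∀ {u} → SlimView u → Fin 3
  partOf (left _ _) = zero
  partOf (right _ _) = suc zero
  partOf top = suc (suc zero)

  inPart : ∀ i {u} (view : SlimView u) → S i u ≡ true → i ≡ partOf view
  inPart zero (left _ _) _ = refl
  inPart (suc zero) (right _ _) _ = refl
  inPart (suc (suc zero)) top _ = refl
  inPart (suc (suc zero)) (left a s) p = ⊥-elim (true≢false p (cong isFatB s))
  inPart (suc (suc zero)) (right b s) p = ⊥-elim (true≢false p (cong isFatB s))
  inPart zero (right _ _) ()
  inPart zero top ()
  inPart (suc zero) (left _ _) ()
  inPart (suc zero) top ()

  distinctParts : ∀ {i j u v} (vu : SlimView u) (vv : SlimView v) → i ≢ j →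
                  S i u ≡ true → S j v ≡ true → partOf vu ≢ partOf vv
  distinctParts {i} {j} vu vv i≢j iu jv p = i≢j (trans (inPart i vu iu) (trans p (≡.sym (inPart j vv jv))))

  leftPole rightPole : (A ⊎ B) ⊎ ⊤
  leftPole = inj₁ (inj₁ (pole OX))
  rightPole = inj₁ (inj₂ (pole OY))

  leftFatNbr : ∀ a w → FatNbrOn J (inj₁ (inj₁ a)) w → w ≡ leftPole
  leftFatNbr a (inj₁ (inj₁ a')) (_ , fat-a') = cong (λ x → inj₁ (inj₁ x)) (pole-unique OX a' fat-a')
  leftFatNbr a (inj₁ (inj₂ _)) (() , _)
  leftFatNbr a (inj₂ _) (_ , ())

  rightFatNbr : ∀ b w → FatNbrOn J (inj₁ (inj₂ b)) w → w ≡ rightPole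
  rightFatNbr b (inj₁ (inj₁ _)) (() , _)
  rightFatNbr b (inj₁ (inj₂ b')) (_ , fat-b') = cong (λ x → inj₁ (inj₂ x)) (pole-unique OY b' fat-b')
  rightFatNbr b (inj₂ _) (_ , ())

  leftPole≢rightPole : leftPole ≢ rightPole
  leftPole≢rightPole ()

  closedPart : ∀ {u} (view : SlimView u) w → FatNbrOn J u w → S (partOf view) w ≡ true
  closedPart (left a _) w uw rewrite leftFatNbr a w uw = refl
  closedPart (right b _) w uw rewrite rightFatNbr b w uw = refl
  closedPart top (inj₁ (inj₁ a)) (_ , fat-a) rewrite fat-a = refl
  closedPart top (inj₁ (inj₂ b)) (_ , fat-b) rewrite fat-b = refl
  closedPart top (inj₂ _) (_ , ())

  partHasSlim : ∀ i u → S i u ≡ true → label J u ≡ fat →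
                ∃ λ w → S i w ≡ true × edge J u w ≡ true × label J w ≡ slim
  partHasSlim zero (inj₁ (inj₁ a)) _ fat-a =
    let (a' , aa' , slim-a') = fat-slimNbr X a fat-a in inj₁ (inj₁ a') , refl , aa' , slim-a'
  partHasSlim (suc zero) (inj₁ (inj₂ b)) _ fat-b =
    let (b' , bb' , slim-b') = fat-slimNbr Y b fat-b in inj₁ (inj₂ b') , refl , bb' , slim-b'
  partHasSlim (suc (suc zero)) (inj₁ _) _ _ = inj₂ tt , refl , refl , refl
  partHasSlim (suc (suc zero)) (inj₂ _) _ ()
  partHasSlim zero (inj₁ (inj₂ _)) ()
  partHasSlim zero (inj₂ _) ()
  partHasSlim (suc zero) (inj₁ (inj₁ _)) ()
  partHasSlim (suc zero) (inj₂ _) ()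

  covering : ∀ u → ∃ λ i → S i u ≡ true
  covering (inj₁ (inj₁ _)) = zero , refl
  covering (inj₁ (inj₂ _)) = suc zero , refl
  covering (inj₂ _) = suc (suc zero) , refl

  atMostOne : ∀ i j u v → i ≢ j → label J u ≡ slim → label J v ≡ slim →
              S i u ≡ true → S j v ≡ true → ∀ w w' →
              FatNbrOn J u w → FatNbrOn J v w → FatNbrOn J u w' → FatNbrOn J v w' → w ≡ w'
  atMostOne i j u v i≢j su sv iu jv w w' uw vw uw' vw' with slimView u su | slimView v sv
  ... | left a _ | _ = trans (leftFatNbr a w uw) (≡.sym (leftFatNbr a w' uw'))
  ... | right b _ | _ = trans (rightFatNbr b w uw) (≡.sym (rightFatNbr b w' uw'))
  ... | top | left a _ = trans (leftFatNbr a w vw) (≡.sym (leftFatNbr a w' vw'))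
  ... | top | right b _ = trans (rightFatNbr b w vw) (≡.sym (rightFatNbr b w' vw'))
  ... | top | top = ⊥-elim (distinctParts top top i≢j iu jv refl)

  sharedIsAdj : ∀ i j u v → i ≢ j → label J u ≡ slim → label J v ≡ slim →
                S i u ≡ true → S j v ≡ true → SharedFat J u v → edge J u v ≡ true
  sharedIsAdj i j u v i≢j su sv iu jv (w , uw , vw) with slimView u su | slimView v sv
  ... | left a s | left a' s' = ⊥-elim (distinctParts (left a s) (left a' s') i≢j iu jv refl)
  ... | left a _ | right b _ = ⊥-elim (leftPole≢rightPole (trans (≡.sym (leftFatNbr a w uw)) (rightFatNbr b w vw)))
  ... | left _ _ | top = refl
  ... | right b _ | left a _ = ⊥-elim (leftPole≢rightPole (trans (≡.sym (leftFatNbr a w vw)) (rightFatNbr b w uw)))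
  ... | right b s | right b' s' = ⊥-elim (distinctParts (right b s) (right b' s') i≢j iu jv refl)
  ... | right _ _ | top = refl
  ... | top | left _ _ = refl
  ... | top | right _ _ = refl
  ... | top | top = ⊥-elim (distinctParts top top i≢j iu jv refl)

  adjIsShared : ∀ i j u v → i ≢ j → label J u ≡ slim → label J v ≡ slim →
                S i u ≡ true → S j v ≡ true → edge J u v ≡ true → SharedFat J u v
  adjIsShared i j u v i≢j su sv iu jv uv with slimView u su | slimView v sv
  ... | left a s | left a' s' = ⊥-elim (distinctParts (left a s) (left a' s') i≢j iu jv refl)
  ... | left a s | top = leftPole , (pole-adj OX a s , pole-fat OX) , (refl , pole-fat OX)
  ... | right b s | right b' s' = ⊥-elim (distinctParts (right b s) (right b' s') i≢j iu jv refl)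
  ... | right b s | top = rightPole , (pole-adj OY b s , pole-fat OY) , (refl , pole-fat OY)
  ... | top | left a s = leftPole , (refl , pole-fat OX) , (pole-adj OX a s , pole-fat OX)
  ... | top | right b s = rightPole , (refl , pole-fat OY) , (pole-adj OY b s , pole-fat OY)
  ... | top | top = ⊥-elim (distinctParts top top i≢j iu jv refl)

  joinIsSum : IsSumOn J 3 S
  joinIsSum = record
    { partHasSlim = partHasSlim
    ; covering = covering
    ; slimDisjoint = λ i j u su iu ju → let view = slimView u su in
                       trans (inPart i view iu) (≡.sym (inPart j view ju))
    ; fatClosed = λ i u w su iu uw → let view = slimView u su in
                    subst (λ k → S k w ≡ true) (≡.sym (inPart i view iu)) (closedPart view w uw)
    ; atMostOne = atMostOne
    ; sharedIsAdj = sharedIsAdj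
    ; adjIsShared = adjIsShared }

  leftIncl : X ⇒ J
  leftIncl = record
    { vmap = λ a → inj₁ (inj₁ a) ; injective = λ _ _ p → inj₁-injective (inj₁-injective p)
    ; edge-pres = λ _ _ → refl ; label-pres = λ _ → refl }

  leftOnto : OntoPart leftIncl (S zero)
  leftOnto (inj₁ (inj₁ a)) = (λ _ → a , refl) , (λ _ → refl)
  leftOnto (inj₁ (inj₂ _)) = (λ ()) , (λ { (_ , ()) })
  leftOnto (inj₂ _) = (λ ()) , (λ { (_ , ()) })

  rightIncl : Y ⇒ J
  rightIncl = record
    { vmap = λ b → inj₁ (inj₂ b) ; injective = λ _ _ p → inj₂-injective (inj₁-injective p)
    ; edge-pres = λ _ _ → refl ; label-pres = λ _ → refl }

  rightOnto : OntoPart rightIncl (S (suc zero))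
  rightOnto (inj₁ (inj₂ b)) = (λ _ → b , refl) , (λ _ → refl)
  rightOnto (inj₁ (inj₁ _)) = (λ ()) , (λ { (_ , ()) })
  rightOnto (inj₂ _) = (λ ()) , (λ { (_ , ()) })

  coreMap : Fin 3 → (A ⊎ B) ⊎ ⊤
  coreMap zero = inj₂ tt
  coreMap (suc zero) = leftPole
  coreMap (suc (suc zero)) = rightPole

  core : onFin h₂ ⇒ J
  core = record { vmap = coreMap ; injective = inj' ; edge-pres = pres ; label-pres = lpres }
    where
    inj' : ∀ x y → coreMap x ≡ coreMap y → x ≡ y
    inj' zero zero _ = refl
    inj' (suc zero) (suc zero) _ = refl
    inj' (suc (suc zero)) (suc (suc zero)) _ = refl
    inj' zero (suc zero) ()
    inj' zero (suc (suc zero)) ()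
    inj' (suc zero) zero ()
    inj' (suc zero) (suc (suc zero)) ()
    inj' (suc (suc zero)) zero ()
    inj' (suc (suc zero)) (suc zero) ()
    pres : ∀ x y → edge J (coreMap x) (coreMap y) ≡ adj h₂ x y
    pres zero zero = refl
    pres zero (suc zero) = refl
    pres zero (suc (suc zero)) = refl
    pres (suc zero) zero = refl
    pres (suc zero) (suc zero) = edge-irrefl X (pole OX)
    pres (suc zero) (suc (suc zero)) = refl
    pres (suc (suc zero)) zero = refl
    pres (suc (suc zero)) (suc zero) = refl
    pres (suc (suc zero)) (suc (suc zero)) = edge-irrefl Y (pole OY)
    lpres : ∀ x → label J (coreMap x) ≡ lab h₂ x
    lpres zero = refl
    lpres (suc zero) = pole-fat OX
    lpres (suc (suc zero)) = pole-fat OY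

  coreOnto : OntoPart core (S (suc (suc zero)))
  coreOnto w = into w , λ { (x , refl) → back x }
    where
    back : ∀ x → S (suc (suc zero)) (coreMap x) ≡ true
    back zero = refl
    back (suc zero) rewrite pole-fat OX = refl
    back (suc (suc zero)) rewrite pole-fat OY = refl
    into : ∀ w → S (suc (suc zero)) w ≡ true → ∃ λ x → coreMap x ≡ w
    into (inj₁ (inj₁ a)) p = suc zero , cong (λ x → inj₁ (inj₁ x)) (≡.sym (pole-unique OX a (isFatB-sound p)))
    into (inj₁ (inj₂ b)) p = suc (suc zero) , cong (λ x → inj₁ (inj₂ x)) (≡.sym (pole-unique OY b (isFatB-sound p)))
    into (inj₂ tt) _ = zero , refl

joinSum : (F : Family) {VX VY : FinType} {X : HGraphOn (Carrier VX)} {Y : HGraphOn (Carrier VY)} →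
          (OX : OneFat X) (OY : OneFat Y) → realise VX X ∈ᶠ F → realise VY Y ∈ᶠ F → h₂ ∈ᶠ F →
          SumOf F (realise ((VX ⊎ᶠ VY) ⊎ᶠ point) (apex (X ⊔ Y)))
joinSum F {VX} {VY} OX OY X∈F Y∈F h₂∈F = 3 , _ , realiseSum joinIsSum , parts
  where
  open Join OX OY
  parts : ∀ i → ∃ λ g → g ∈ᶠ F × EmbedsOnto g (realise ((VX ⊎ᶠ VY) ⊎ᶠ point) J)
                                          (λ x → S i (decode ((VX ⊎ᶠ VY) ⊎ᶠ point) x))
  parts zero = _ , X∈F , Realise.onto {VX} leftIncl (S zero) leftOnto
  parts (suc zero) = _ , Y∈F , Realise.onto {VY} rightIncl (S (suc zero)) rightOnto
  parts (suc (suc zero)) = h₂ , h₂∈F , Realise.onto {finite 3} core (S (suc (suc zero))) coreOnto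

idEmbedding : (g : HGraph) → Embedding g g
idEmbedding g = record { emb = λ x → x ; inj = λ _ _ p → p ; adj-pres = λ _ _ → refl ; lab-pres = λ _ → refl }

isoRefl : (g : HGraph) → Iso g g
isoRefl g = idEmbedding g , λ v → v , refl

oneFat : (g : HGraph) → IsFatGraph g → ExactlyOneFat g → OneFat (onFin g)
oneFat g fatGraph (f , fat-f , unique) = record
  { pole = f ; pole-fat = fat-f ; pole-unique = unique
  ; pole-adj = λ x slim-x → let (f' , xf' , fat-f') = fatGraph x slim-x in subst (Adj g x) (unique f' fat-f') xf' }

module _ {V : FinType} {X : HGraphOn (Carrier V)} (O : OneFat X) where

  realise-fatGraph : IsFatGraph (realise V X)
  realise-fatGraph x slim-x =
    encode V (pole O) , atEncode V (λ w → edge X (decode V x) w ≡ true) (pole-adj O _ slim-x)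
                      , atEncode V (λ w → label X w ≡ fat) (pole-fat O)

  realise-oneFat : ExactlyOneFat (realise V X)
  realise-oneFat = encode V (pole O) , atEncode V (λ w → label X w ≡ fat) (pole-fat O)
                 , λ x fat-x → decode-injective V x _ (trans (pole-unique O _ fat-x) (≡.sym (decode-encode V _)))

star-closed : (g : HGraph) (P : Fin (n g) → Set) → (∀ x y → P x → SlimAdj g x y → P y) →
              ∀ {x y} → Star (SlimAdj g) x y → P x → P y
star-closed g P closed ε px = px
star-closed g P closed (xz ◅ zy) px = star-closed g P closed zy (closed _ _ px xz)

separated : (g : HGraph) (P : Fin (n g) → Set) → (∀ x y → P x → SlimAdj g x y → P y) →
            ∀ x y → IsSlim g x → IsSlim g y → P x → ¬ P y → ¬ SlimConnected g
separated g P closed x y slim-x slim-y px ¬py connected = ¬py (star-closed g P closed (connected x y slim-x slim-y) px)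

private
  other : Fin 2 → Fin 2
  other zero = suc zero
  other (suc zero) = zero

  other≢ : ∀ i → i ≢ other i
  other≢ zero ()
  other≢ (suc zero) ()

-- If all slim vertices share one fat neighbour, any two slim vertices in different
-- summands are adjacent; so a decomposition into two parts makes the slim graph connected.
indecomposable : (g : HGraph) → OneFat (onFin g) → ¬ SlimConnected g → Indecomposable g
indecomposable g O disconnected (S , sum , nonEmpty) = disconnected connected
  where
  open IsSum sum
  cross : ∀ i j x y → i ≢ j → IsSlim g x → IsSlim g y → S i x ≡ true → S j y ≡ true → SlimAdj g x y
  cross i j x y i≢j slim-x slim-y ix jy =
    proj₁ (oneIffAdj i j x y i≢j slim-x slim-y ix jy)
      (pole O , (pole-adj O x slim-x , pole-fat O) , (pole-adj O y slim-y , pole-fat O)) , slim-x , slim-y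
  slimIn : ∀ i → ∃ λ w → S i w ≡ true × IsSlim g w
  slimIn i with nonEmpty i
  ... | v , iv with lab g v in label-v
  ... | slim = v , iv , label-v
  ... | fat = let (w , iw , _ , slim-w) = hoff i v iv label-v in w , iw , slim-w
  connected : SlimConnected g
  connected x y slim-x slim-y with cover x | cover y
  ... | i , ix | j , jy with i ≟ j
  ... | no i≢j = cross i j x y i≢j slim-x slim-y ix jy ◅ ε
  ... | yes refl = let (w , iw , slim-w) = slimIn (other i) in
      cross i (other i) x w (other≢ i) slim-x slim-w ix iw
    ◅ cross (other i) i w y (λ p → other≢ i (≡.sym p)) slim-w slim-y iw jy ◅ ε

twoSidedCone : {A B : Set} (X : HGraphOn A) (Y : HGraphOn B) → AllSlim X → AllSlim Y → A → HGraphOn ((A ⊎ B) ⊎ ⊤)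
twoSidedCone X Y slimX slimY a₀ = fatCone (X ⊔ Y) (⊔-allSlim {X = X} {Y = Y} slimX slimY) (inj₁ a₀)

-- A two-sided cone belongs to O: it is fat with one fat vertex, has two slim vertices,
-- and its slim graph is disconnected, hence it is indecomposable.
twoSidedCone-inO : {VX VY : FinType} {X : HGraphOn (Carrier VX)} {Y : HGraphOn (Carrier VY)}
                   (slimX : AllSlim X) (slimY : AllSlim Y) (x₀ : Carrier VX) (y₀ : Carrier VY) →
                   InO (realise ((VX ⊎ᶠ VY) ⊎ᶠ point) (twoSidedCone X Y slimX slimY x₀))
twoSidedCone-inO {VX} {VY} {X} {Y} slimX slimY x₀ y₀ =
  inj₂ (indecomposable Kr (oneFat Kr (realise-fatGraph {V} O) (realise-oneFat {V} O)) disconnected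
       , realise-fatGraph {V} O , twoSlim , realise-oneFat {V} O)
  where
  V : FinType
  V = (VX ⊎ᶠ VY) ⊎ᶠ point
  K : HGraphOn (Carrier V)
  K = twoSidedCone X Y slimX slimY x₀
  Kr : HGraph
  Kr = realise V K
  O : OneFat K
  O = fatCone-oneFat (X ⊔ Y) (⊔-allSlim {X = X} {Y = Y} slimX slimY) (inj₁ x₀)
  x y : Fin (n Kr)
  x = encode V (inj₁ (inj₁ x₀))
  y = encode V (inj₁ (inj₂ y₀))
  slim-x : IsSlim Kr x
  slim-x = atEncode V (λ w → label K w ≡ slim) {inj₁ (inj₁ x₀)} (slimX x₀)
  slim-y : IsSlim Kr y
  slim-y = atEncode V (λ w → label K w ≡ slim) {inj₁ (inj₂ y₀)} (slimY y₀)
  onLeft : (Carrier VX ⊎ Carrier VY) ⊎ ⊤ → Set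
  onLeft (inj₁ (inj₁ _)) = ⊤
  onLeft _ = ⊥
  onLeft-closed : ∀ u w → onLeft u → edge K u w ≡ true → label K w ≡ slim → onLeft w
  onLeft-closed (inj₁ (inj₁ _)) (inj₁ (inj₁ _)) _ _ _ = tt
  onLeft-closed (inj₁ (inj₁ _)) (inj₁ (inj₂ _)) _ () _
  onLeft-closed (inj₁ (inj₁ _)) (inj₂ _) _ _ ()
  twoSlim : AtLeastTwoSlim Kr
  twoSlim = x , y , (λ p → left≢right (trans (≡.sym (decode-encode V (inj₁ (inj₁ x₀)))) (trans (cong (decode V) p) (decode-encode V (inj₁ (inj₂ y₀))))))
          , slim-x , slim-y
    where
    left≢right : inj₁ (inj₁ x₀) ≢ inj₁ (inj₂ y₀)
    left≢right ()
  disconnected : ¬ SlimConnected Kr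
  disconnected = separated Kr (λ v → onLeft (decode V v))
    (λ u w lu (uw , _ , slim-w) → onLeft-closed (decode V u) (decode V w) lu uw slim-w)
    x y slim-x slim-y (atEncode V onLeft {inj₁ (inj₁ x₀)} tt) (subst onLeft (decode-encode V (inj₁ (inj₂ y₀))))

_⊆_ : ∀ {n} → (Fin n → Bool) → (Fin n → Bool) → Set
P ⊆ Q = ∀ v → P v ≡ true → Q v ≡ true

anyᵇ : ∀ {n} → (Fin n → Bool) → Bool
anyᵇ {zero} f = false
anyᵇ {suc n} f = f zero ∨ anyᵇ (f ∘ suc)

anyᵇ-sound : ∀ {n} (f : Fin n → Bool) → anyᵇ f ≡ true → ∃ λ v → f v ≡ true
anyᵇ-sound {suc n} f p with ∨-true {f zero} p
... | inj₁ here = zero , here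
... | inj₂ there = let (v , fv) = anyᵇ-sound (f ∘ suc) there in suc v , fv

anyᵇ-complete : ∀ {n} (f : Fin n → Bool) v → f v ≡ true → anyᵇ f ≡ true
anyᵇ-complete f zero fv = ∨-trueˡ fv
anyᵇ-complete f (suc v) fv = ∨-trueʳ {f zero} (anyᵇ-complete (f ∘ suc) v fv)

count : ∀ {n} → (Fin n → Bool) → ℕ
count P = sum (tabulate (λ v → if P v then 1 else 0))

slimCount-count : (g : HGraph) → slimCount g ≡ count (λ v → isSlimB (lab g v))
slimCount-count g = cong sum (map-tabulate (λ v → v) (λ v → if isSlimB (lab g v) then 1 else 0))

count-≤ : ∀ {n} (P : Fin n → Bool) → count P ≤ n
count-≤ {zero} P = z≤n
count-≤ {suc n} P with P zero
... | true = s≤s (count-≤ (P ∘ suc))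
... | false = m≤n⇒m≤1+n (count-≤ (P ∘ suc))

count-pos : ∀ {n} (P : Fin n → Bool) v → P v ≡ true → 1 ≤ count P
count-pos P zero Pv rewrite Pv = s≤s z≤n
count-pos P (suc v) Pv with P zero
... | true = s≤s z≤n
... | false = count-pos (P ∘ suc) v Pv

count-split : ∀ {n} (P Q : Fin n → Bool) →
              count (λ v → P v ∧ Q v) + count (λ v → P v ∧ not (Q v)) ≡ count P
count-split {zero} P Q = refl
count-split {suc n} P Q with P zero | Q zero
... | true | true = cong suc (count-split (P ∘ suc) (Q ∘ suc))
... | true | false = trans (+-suc _ _) (cong suc (count-split (P ∘ suc) (Q ∘ suc)))
... | false | _ = count-split (P ∘ suc) (Q ∘ suc)

count-mono : ∀ {n} (P Q : Fin n → Bool) → P ⊆ Q → count P ≤ count Q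
count-mono {zero} P Q P⊆Q = z≤n
count-mono {suc n} P Q P⊆Q with P zero in P0 | Q zero in Q0
... | true | true = s≤s (count-mono (P ∘ suc) (Q ∘ suc) (P⊆Q ∘ suc))
... | true | false = ⊥-elim (true≢false (P⊆Q zero P0) Q0)
... | false | true = m≤n⇒m≤1+n (count-mono (P ∘ suc) (Q ∘ suc) (P⊆Q ∘ suc))
... | false | false = count-mono (P ∘ suc) (Q ∘ suc) (P⊆Q ∘ suc)

count-reflects : ∀ {n} (P Q : Fin n → Bool) → P ⊆ Q → count Q ≤ count P → Q ⊆ P
count-reflects {suc n} P Q P⊆Q Q≤P v Qv with P zero in P0 | Q zero in Q0 | v
... | true  | false | _     = ⊥-elim (true≢false (P⊆Q zero P0) Q0)
... | false | true  | _     = ⊥-elim (<-irrefl refl (≤-trans Q≤P (count-mono (P ∘ suc) (Q ∘ suc) (P⊆Q ∘ suc))))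
... | true  | true  | zero  = P0
... | false | false | zero  = ⊥-elim (true≢false Qv Q0)
... | true  | true  | suc w = count-reflects (P ∘ suc) (Q ∘ suc) (P⊆Q ∘ suc) (≤-pred Q≤P) w Qv
... | false | false | suc w = count-reflects (P ∘ suc) (Q ∘ suc) (P⊆Q ∘ suc) Q≤P w Qv

enumerate : ∀ {n} (P : Fin n → Bool) → Fin (count P) → Fin n
enumerate {suc n} P i with P zero
enumerate {suc n} P zero | true = zero
enumerate {suc n} P (suc i) | true = suc (enumerate (P ∘ suc) i)
enumerate {suc n} P i | false = suc (enumerate (P ∘ suc) i)

enumerate-member : ∀ {n} (P : Fin n → Bool) i → P (enumerate P i) ≡ true
enumerate-member {suc n} P i with P zero in P0
enumerate-member {suc n} P zero | true = P0
enumerate-member {suc n} P (suc i) | true = enumerate-member (P ∘ suc) i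
enumerate-member {suc n} P i | false = enumerate-member (P ∘ suc) i

enumerate-injective : ∀ {n} (P : Fin n → Bool) i j → enumerate P i ≡ enumerate P j → i ≡ j
enumerate-injective {suc n} P i j p with P zero
enumerate-injective {suc n} P zero zero _ | true = refl
enumerate-injective {suc n} P (suc i) (suc j) p | true =
  cong suc (enumerate-injective (P ∘ suc) i j (suc-injective p))
enumerate-injective {suc n} P zero (suc _) () | true
enumerate-injective {suc n} P (suc _) zero () | true
enumerate-injective {suc n} P i j p | false = enumerate-injective (P ∘ suc) i j (suc-injective p)

-- An increasing sequence of subsets of Fin n stops growing at some stage,
-- since each proper growth step increases the count, which is bounded by n.
stabilises : ∀ {n} (R : ℕ → Fin n → Bool) → (∀ k → R k ⊆ R (suc k)) → ∃ λ j → R (suc j) ⊆ R j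
stabilises {n} R increasing with growth (suc n)
  where
  growth : ∀ k → (∃ λ j → R (suc j) ⊆ R j) ⊎ (k ≤ count (R k))
  growth zero = inj₂ z≤n
  growth (suc k) with growth k
  ... | inj₁ stable = inj₁ stable
  ... | inj₂ k≤Rk with count (R (suc k)) ≤? count (R k)
  ...   | yes noGrowth = inj₁ (k , count-reflects (R k) (R (suc k)) (increasing k) noGrowth)
  ...   | no grows = inj₂ (≤-trans (s≤s k≤Rk) (≰⇒> grows))
... | inj₁ stable = stable
... | inj₂ tooMany = ⊥-elim (<-irrefl refl (≤-trans tooMany (count-≤ (R (suc n)))))

record Cut (g : HGraph) : Set where
  field
    side   : Fin (n g) → Bool
    closed : ∀ y z → side y ≡ true → SlimAdj g y z → side z ≡ true
    c d    : Fin (n g)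
    slim-c : IsSlim g c
    slim-d : IsSlim g d
    side-c : side c ≡ true
    side-d : side d ≡ false

slimAdj-sym : (g : HGraph) → ∀ {y z} → SlimAdj g y z → SlimAdj g z y
slimAdj-sym g {y} {z} (yz , slim-y , slim-z) = trans (HGraph.sym g z y) yz , slim-z , slim-y

isSlimB-sound : ∀ {l} → isSlimB l ≡ true → l ≡ slim
isSlimB-sound {slim} _ = refl

isSlimB-complete : ∀ {l} → l ≡ slim → isSlimB l ≡ true
isSlimB-complete refl = refl

-- The slim vertices reachable from a slim vertex x₀ form a decidable set, computed as the
-- limit of the sets reachable in k steps; either it contains every slim vertex, or it is a cut.
module Reach (g : HGraph) (x₀ : Fin (n g)) (slim-x₀ : IsSlim g x₀) where

  slimEdge : Fin (n g) → Fin (n g) → Bool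
  slimEdge y z = adj g y z ∧ (isSlimB (lab g y) ∧ isSlimB (lab g z))

  within : ℕ → Fin (n g) → Bool
  within zero y = does (x₀ ≟ y)
  within (suc k) y = within k y ∨ anyᵇ (λ z → within k z ∧ slimEdge z y)

  within-sound : ∀ k y → within k y ≡ true → Star (SlimAdj g) x₀ y
  within-sound zero y p with x₀ ≟ y
  ... | yes refl = ε
  within-sound zero y () | no _
  within-sound (suc k) y p with ∨-true {within k y} p
  ... | inj₁ near = within-sound k y near
  ... | inj₂ step =
    let (z , q) = anyᵇ-sound (λ z → within k z ∧ slimEdge z y) step
        zy = ∧-trueʳ {within k z} q
        slims = ∧-trueʳ {adj g z y} zy
    in within-sound k z (∧-trueˡ q) ◅◅
       ((∧-trueˡ zy , isSlimB-sound (∧-trueˡ slims) , isSlimB-sound (∧-trueʳ {isSlimB (lab g z)} slims)) ◅ ε)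

  within-x₀ : ∀ k → within k x₀ ≡ true
  within-x₀ zero with x₀ ≟ x₀
  ... | yes _ = refl
  ... | no x₀≢x₀ = ⊥-elim (x₀≢x₀ refl)
  within-x₀ (suc k) = ∨-trueˡ (within-x₀ k)

  fixpoint : ∃ λ j → within (suc j) ⊆ within j
  fixpoint = stabilises within (λ k y → ∨-trueˡ)

  stage : ℕ
  stage = proj₁ fixpoint

  component : Fin (n g) → Bool
  component = within stage

  component-closed : ∀ y z → component y ≡ true → SlimAdj g y z → component z ≡ true
  component-closed y z cy (yz , slim-y , slim-z) =
    proj₂ fixpoint z (∨-trueʳ {component z} (anyᵇ-complete (λ w → component w ∧ slimEdge w z) y
      (∧-true cy (∧-true yz (∧-true (isSlimB-complete slim-y) (isSlimB-complete slim-z))))))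

  escapes : Fin (n g) → Bool
  escapes z = isSlimB (lab g z) ∧ not (component z)

  cutOrConnected : SlimConnected g ⊎ Cut g
  cutOrConnected with anyᵇ escapes in someEscape
  ... | true = let (d , q) = anyᵇ-sound escapes someEscape in inj₂ (record
    { side = component ; closed = component-closed ; c = x₀ ; d = d ; slim-c = slim-x₀
    ; slim-d = isSlimB-sound (∧-trueˡ q) ; side-c = within-x₀ stage
    ; side-d = not-true (∧-trueʳ {isSlimB (lab g d)} q) })
  ... | false = inj₁ λ y y' slim-y slim-y' →
      reverse (slimAdj-sym g) (within-sound stage y (reached y slim-y)) ◅◅ within-sound stage y' (reached y' slim-y')
    where
    reached : ∀ y → IsSlim g y → component y ≡ true
    reached y slim-y with component y in cy
    ... | true = refl
    ... | false = ⊥-elim (true≢false (anyᵇ-complete escapes y (∧-true (isSlimB-complete slim-y) (cong not cy)))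
                                     someEscape)

h₂-slim : ∀ v → IsSlim h₂ v → v ≡ zero
h₂-slim zero _ = refl
h₂-slim (suc zero) ()
h₂-slim (suc (suc zero)) ()

intoH₂-slimUnique : {g : HGraph} → Embedding g h₂ → ∀ x y → IsSlim g x → IsSlim g y → x ≡ y
intoH₂-slimUnique e x y slim-x slim-y =
  inj e x y (trans (h₂-slim _ (trans (lab-pres e x) slim-x)) (≡.sym (h₂-slim _ (trans (lab-pres e y) slim-y))))

intoH₂-slimConnected : {g : HGraph} → Embedding g h₂ → SlimConnected g
intoH₂-slimConnected e x y slim-x slim-y with intoH₂-slimUnique e x y slim-x slim-y
... | refl = ε

_∘ᴱ_ : {g h k : HGraph} → Embedding h k → Embedding g h → Embedding g k
e₂ ∘ᴱ e₁ = record
  { emb = λ x → emb e₂ (emb e₁ x) ; inj = λ x y p → inj e₁ x y (inj e₂ _ _ p)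
  ; adj-pres = λ x y → trans (adj-pres e₂ _ _) (adj-pres e₁ x y)
  ; lab-pres = λ x → trans (lab-pres e₂ _) (lab-pres e₁ x) }

record Situation (H : Family) (h : HGraph) : Set where
  field
    hOneFat    : OneFat (onFin h)
    cut        : Cut h
    host       : HGraph
    host∈H     : H host
    hostOneFat : OneFat (onFin host)
    hostEmb    : Embedding h host

-- Every slim-disconnected h ∈ H̄ is in this situation: h is not h₂, so it lies in O; and its
-- host in H ⊆ O is not h₂ either, as h has two slim vertices.
situation : (H : Family) → (∀ g → H g → InO g) → (h : HGraph) → HBar H h → ¬ SlimConnected h →
            Situation H h
situation H H⊆O h (inj₁ (e , _)) disconnected = ⊥-elim (disconnected (intoH₂-slimConnected e))
situation H H⊆O h (inj₂ (inj₁ (e , _) , _)) disconnected = ⊥-elim (disconnected (intoH₂-slimConnected e))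
situation H H⊆O h (inj₂ (inj₂ (_ , fatGraph , (x , y , x≢y , slim-x , slim-y) , oneFat-h) , h' , h'∈H , ι))
          disconnected with Reach.cutOrConnected h x slim-x | H⊆O h' h'∈H
... | inj₁ connected | _ = ⊥-elim (disconnected connected)
... | inj₂ _ | inj₁ (e , _) = ⊥-elim (x≢y (intoH₂-slimUnique (e ∘ᴱ ι) x y slim-x slim-y))
... | inj₂ cut | inj₂ (_ , fatGraph' , _ , oneFat-h') = record
  { hOneFat = oneFat h fatGraph oneFat-h ; cut = cut ; host = h' ; host∈H = h'∈H
  ; hostOneFat = oneFat h' fatGraph' oneFat-h' ; hostEmb = ι }

apex-connected : (V : FinType) (X : HGraphOn (Carrier V)) → Connected (realise (V ⊎ᶠ point) (apex X))
apex-connected V X x y = toApex x ◅◅ reverse (λ {u} {w} uw → trans (HGraph.sym G w u) uw) (toApex y)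
  where
  W : FinType
  W = V ⊎ᶠ point
  G : HGraph
  G = realise W (apex X)
  top : Fin (n G)
  top = encode W (inj₂ tt)
  toApex : ∀ x → Star (Adj G) x top
  toApex x with decode W x in x-is
  ... | inj₁ a = cong₂ (coneEdge (edge X)) x-is (decode-encode W (inj₂ tt)) ◅ ε
  ... | inj₂ tt = subst (λ z → Star (Adj G) z top) (decode-injective W _ _ (trans (decode-encode W _) (≡.sym x-is))) ε

apex-allSlim : {A : Set} {X : HGraphOn A} → AllSlim X → AllSlim (apex X)
apex-allSlim slimX (inj₁ a) = slimX a
apex-allSlim slimX (inj₂ _) = refl

join-noSharedFat : {A B : Set} {X : HGraphOn A} {Y : HGraphOn B} (a : A) (b : B) →
                   ¬ SharedFat (apex (X ⊔ Y)) (inj₁ (inj₁ a)) (inj₁ (inj₂ b))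
join-noSharedFat a b (inj₁ (inj₁ _) , _ , (() , _))
join-noSharedFat a b (inj₁ (inj₂ _) , (() , _) , _)
join-noSharedFat a b (inj₂ _ , (_ , ()) , _)

strictCover : (F : Family) {V W : FinType} {X : HGraphOn (Carrier V)} {Y : HGraphOn (Carrier W)} →
              (e : X ⇒ Y) → SlimOnto e → SumOf F (realise W Y) → StrictCover F (realise V X)
strictCover F {V} {W} e onto sum = record
  { cov = realise W _ ; isSum = sum ; incl = Realise.embedding {V} {W} e
  ; strict = Realise.slimCovered {V} {W} e onto }

-- Whether two given vertices of g have a common fat neighbour in a cover is invariant
-- under equivalence; covers differing in this witness that g has no unique cover.
module _ {F : Family} {g : HGraph} (x y : Fin (n g)) where

  SharedInCover : StrictCover F g → Set
  SharedInCover c = ∃ λ f → FatNbr (cov c) (emb (incl c) x) f × FatNbr (cov c) (emb (incl c) y) f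

  shared-transfer : ∀ c c' → EquivCover c c' → SharedInCover c → SharedInCover c'
  shared-transfer c c' ((φ , _) , commutes) (f , (xf , fat-f) , (yf , _)) =
    emb φ f , (moved x xf , fat-φf) , (moved y yf , fat-φf)
    where
    fat-φf : IsFatV (cov c') (emb φ f)
    fat-φf = trans (lab-pres φ f) fat-f
    moved : ∀ z → Adj (cov c) (emb (incl c) z) f → Adj (cov c') (emb (incl c') z) (emb φ f)
    moved z zf = subst (λ w → Adj (cov c') w (emb φ f)) (commutes z) (trans (adj-pres φ _ f) zf)

  shared-reflect : ∀ c c' → EquivCover c c' → SharedInCover c' → SharedInCover c
  shared-reflect c c' ((φ , onto) , commutes) (f' , (xf' , fat-f') , (yf' , _)) with onto f'
  ... | f , refl = f , (moved x xf' , fat-f) , (moved y yf' , fat-f)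
    where
    fat-f : IsFatV (cov c) f
    fat-f = trans (≡.sym (lab-pres φ f)) fat-f'
    moved : ∀ z → Adj (cov c') (emb (incl c') z) (emb φ f) → Adj (cov c) (emb (incl c) z) f
    moved z zf = trans (≡.sym (adj-pres φ _ f)) (subst (λ w → Adj (cov c') w (emb φ f)) (≡.sym (commutes z)) zf)

  notUnique : ∀ c₁ c₂ → SharedInCover c₁ → ¬ SharedInCover c₂ → ¬ UniqueStrictCover F g
  notUnique c₁ c₂ shared₁ unshared₂ (c , equivalent) =
    unshared₂ (shared-transfer c c₂ (equivalent c₂) (shared-reflect c c₁ (equivalent c₁) shared₁))

split≤ : ∀ t c d → t ≤ c + d → ∃ λ x → ∃ λ y → x ≤ c × y ≤ d × x + y ≡ t
split≤ t c d t≤ with t ≤? c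
... | yes t≤c = t , 0 , t≤c , z≤n , +-identityʳ t
... | no t≰c = c , t ∸ c , ≤-refl , m≤n+o⇒m∸n≤o t c t≤ , m+[n∸m]≡n (<⇒≤ (≰⇒> t≰c))

record Blocks (p q N : ℕ) : Set where
  field
    a₁ b₁ a₂ b₂ : ℕ
    a₁≤ : suc a₁ ≤ p
    b₁≤ : suc b₁ ≤ q
    a₂≤ : suc a₂ ≤ p
    b₂≤ : suc b₂ ≤ q
    order : ((suc a₁ + suc b₁) + (suc a₂ + suc b₂)) + 1 ≡ N

blocks : ∀ p q N → 1 ≤ p → 1 ≤ q → 5 ≤ N → N ≤ 2 * (p + q) + 1 → Blocks p q N
blocks (suc c) (suc d) N _ _ 5≤N N≤ with split≤ (N ∸ 5) (c + d) (c + d) rest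
  where
  double : ∀ c d → 2 * (suc c + suc d) + 1 ≡ 5 + ((c + d) + (c + d))
  double = solve-∀
  rest : N ∸ 5 ≤ (c + d) + (c + d)
  rest = m≤n+o⇒m∸n≤o N 5 (subst (N ≤_) (double c d) N≤)
... | t₁ , t₂ , t₁≤ , t₂≤ , t₁+t₂ with split≤ t₁ c d t₁≤ | split≤ t₂ c d t₂≤
... | a₁ , b₁ , a₁≤ , b₁≤ , a₁+b₁ | a₂ , b₂ , a₂≤ , b₂≤ , a₂+b₂ = record
  { a₁ = a₁ ; b₁ = b₁ ; a₂ = a₂ ; b₂ = b₂
  ; a₁≤ = s≤s a₁≤ ; b₁≤ = s≤s b₁≤ ; a₂≤ = s≤s a₂≤ ; b₂≤ = s≤s b₂≤
  ; order = begin
      ((suc a₁ + suc b₁) + (suc a₂ + suc b₂)) + 1 ≡⟨ regroup a₁ b₁ a₂ b₂ ⟩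
      5 + ((a₁ + b₁) + (a₂ + b₂))                 ≡⟨ cong (5 +_) (cong₂ _+_ a₁+b₁ a₂+b₂) ⟩
      5 + (t₁ + t₂)                               ≡⟨ cong (5 +_) t₁+t₂ ⟩
      5 + (N ∸ 5)                                 ≡⟨ m+[n∸m]≡n 5≤N ⟩
      N                                           ∎ }
  where
  open ≡-Reasoning
  regroup : ∀ a b a' b' → ((suc a + suc b) + (suc a' + suc b')) + 1 ≡ 5 + ((a + b) + (a' + b'))
  regroup = solve-∀

module Construction {H : Family} {h : HGraph} (σ : Situation H h) where
  open Situation σ
  open Cut cut

  inSide outSide : Fin (n h) → Bool
  inSide v = isSlimB (lab h v) ∧ side v
  outSide v = isSlimB (lab h v) ∧ not (side v)

  #in #out : ℕ
  #in = count inSide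
  #out = count outSide

  #in+#out : #in + #out ≡ slimCount h
  #in+#out = trans (count-split (λ v → isSlimB (lab h v)) side) (≡.sym (slimCount-count h))

  1≤#in : 1 ≤ #in
  1≤#in = count-pos inSide c (∧-true (isSlimB-complete slim-c) side-c)

  1≤#out : 1 ≤ #out
  1≤#out = count-pos outSide d (∧-true (isSlimB-complete slim-d) (cong not side-d))

  inner : ∀ {k} → k ≤ #in → Fin k → Fin (n h)
  inner k≤ i = enumerate inSide (inject≤ i k≤)

  outer : ∀ {k} → k ≤ #out → Fin k → Fin (n h)
  outer k≤ j = enumerate outSide (inject≤ j k≤)

  inner-slim : ∀ {k} (k≤ : k ≤ #in) i → IsSlim h (inner k≤ i)
  inner-slim k≤ i = isSlimB-sound (∧-trueˡ (enumerate-member inSide (inject≤ i k≤)))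

  outer-slim : ∀ {k} (k≤ : k ≤ #out) j → IsSlim h (outer k≤ j)
  outer-slim k≤ j = isSlimB-sound (∧-trueˡ (enumerate-member outSide (inject≤ j k≤)))

  inner-side : ∀ {k} (k≤ : k ≤ #in) i → side (inner k≤ i) ≡ true
  inner-side k≤ i = ∧-trueʳ {isSlimB (lab h (inner k≤ i))} (enumerate-member inSide (inject≤ i k≤))

  outer-side : ∀ {k} (k≤ : k ≤ #out) j → side (outer k≤ j) ≡ false
  outer-side k≤ j = not-true (∧-trueʳ {isSlimB (lab h (outer k≤ j))} (enumerate-member outSide (inject≤ j k≤)))

  innerBlock : ∀ {k} → k ≤ #in → HGraphOn (Fin k)
  innerBlock k≤ = slimBlock (onFin h) (inner k≤) (inner-slim k≤)

  outerBlock : ∀ {k} → k ≤ #out → HGraphOn (Fin k)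
  outerBlock k≤ = slimBlock (onFin h) (outer k≤) (outer-slim k≤)

  blocks-slim : ∀ {k l} (k≤ : k ≤ #in) (l≤ : l ≤ #out) → AllSlim (innerBlock k≤ ⊔ outerBlock l≤)
  blocks-slim k≤ l≤ = ⊔-allSlim {X = innerBlock k≤} {Y = outerBlock l≤} (λ _ → refl) (λ _ → refl)

  -- an inner and an outer block together form an induced subgraph of h,
  -- since no slim edge crosses the cut
  blocks⇒h : ∀ {k l} (k≤ : k ≤ #in) (l≤ : l ≤ #out) → (innerBlock k≤ ⊔ outerBlock l≤) ⇒ onFin h
  blocks⇒h k≤ l≤ = ⊔-into
    (block-into (onFin h) (inner k≤) (inner-slim k≤)
      (λ i i' p → inject≤-injective k≤ k≤ i i' (enumerate-injective inSide _ _ p)))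
    (block-into (onFin h) (outer l≤) (outer-slim l≤)
      (λ j j' p → inject≤-injective l≤ l≤ j j' (enumerate-injective outSide _ _ p)))
    (λ i j p → true≢false (trans (cong side (≡.sym p)) (inner-side k≤ i)) (outer-side l≤ j))
    apart
    where
    apart : ∀ i j → adj h (inner k≤ i) (outer l≤ j) ≡ false
    apart i j with adj h (inner k≤ i) (outer l≤ j) in crossing
    ... | false = refl
    ... | true = ⊥-elim (true≢false (closed _ _ (inner-side k≤ i) (crossing , inner-slim k≤ i , outer-slim l≤ j))
                                     (outer-side l≤ j))

  pieceType : ℕ → ℕ → FinType
  pieceType a b = (finite (suc a) ⊎ᶠ finite (suc b)) ⊎ᶠ point

  piece : ∀ {a b} → suc a ≤ #in → suc b ≤ #out → HGraphOn (Carrier (pieceType a b))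
  piece a≤ b≤ = twoSidedCone (innerBlock a≤) (outerBlock b≤) (λ _ → refl) (λ _ → refl) zero

  piece-oneFat : ∀ {a b} (a≤ : suc a ≤ #in) (b≤ : suc b ≤ #out) → OneFat (piece a≤ b≤)
  piece-oneFat a≤ b≤ = fatCone-oneFat _ _ _

  piece-incl : ∀ {a b} (a≤ : suc a ≤ #in) (b≤ : suc b ≤ #out) → (innerBlock a≤ ⊔ outerBlock b≤) ⇒ piece a≤ b≤
  piece-incl a≤ b≤ = cone-incl

  piece-incl-slimOnto : ∀ {a b} (a≤ : suc a ≤ #in) (b≤ : suc b ≤ #out) → SlimOnto (piece-incl a≤ b≤)
  piece-incl-slimOnto a≤ b≤ =
    cone-incl-slimOnto {X = innerBlock a≤ ⊔ outerBlock b≤} {allSlim = blocks-slim a≤ b≤} {a₀ = inj₁ zero}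

  -- adding the fat vertex of h, a piece is an induced subgraph of h and hence of the host
  piece⇒host : ∀ {a b} (a≤ : suc a ≤ #in) (b≤ : suc b ≤ #out) → piece a≤ b≤ ⇒ onFin host
  piece⇒host a≤ b≤ = fromEmbedding hostEmb ∘ᵉ
    cone-into (blocks⇒h a≤ b≤) (pole hOneFat) (pole-fat hOneFat)
      (λ u → pole-adj hOneFat _ (trans (label-pres (blocks⇒h a≤ b≤) u) (blocks-slim a≤ b≤ u)))

  -- a piece lies in O and inside the host, so it belongs to H̄
  piece∈H̄ : ∀ {a b} (a≤ : suc a ≤ #in) (b≤ : suc b ≤ #out) → realise (pieceType a b) (piece a≤ b≤) ∈ᶠ HBar H
  piece∈H̄ {a} {b} a≤ b≤ =
    _ , inj₂ (twoSidedCone-inO (λ _ → refl) (λ _ → refl) zero zero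
             , host , host∈H , Realise.embedding {pieceType a b} {finite (n host)} (piece⇒host a≤ b≤))
      , isoRefl _

  module Counterexample (h₂∈H : h₂ ∈ᶠ H) {a₁ b₁ a₂ b₂ : ℕ}
                        (a₁≤ : suc a₁ ≤ #in) (b₁≤ : suc b₁ ≤ #out) (a₂≤ : suc a₂ ≤ #in) (b₂≤ : suc b₂ ≤ #out) where

    baseType : FinType
    baseType = (finite (suc a₁) ⊎ᶠ finite (suc b₁)) ⊎ᶠ (finite (suc a₂) ⊎ᶠ finite (suc b₂))

    base : HGraphOn (Carrier baseType)
    base = (innerBlock a₁≤ ⊔ outerBlock b₁≤) ⊔ (innerBlock a₂≤ ⊔ outerBlock b₂≤)

    gType : FinType
    gType = baseType ⊎ᶠ point

    g : HGraph
    g = realise gType (apex base)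

    g-slim : AllSlim (apex base)
    g-slim = apex-allSlim {X = base}
      (⊔-allSlim {X = innerBlock a₁≤ ⊔ outerBlock b₁≤} {Y = innerBlock a₂≤ ⊔ outerBlock b₂≤}
        (blocks-slim a₁≤ b₁≤) (blocks-slim a₂≤ b₂≤))

    -- g lies in the join of two copies of the host, which is a sum of members of H
    g-line : SlimLine H g
    g-line = (λ x fat-x → slim≢fat (trans (≡.sym (g-slim (decode gType x))) fat-x))
           , _ , joinSum H {finite (n host)} {finite (n host)} hostOneFat hostOneFat host∈ᶠH host∈ᶠH h₂∈H
           , Realise.embedding {gType} {(finite (n host) ⊎ᶠ finite (n host)) ⊎ᶠ point}
               (apex-map (⊔-map (fromEmbedding hostEmb ∘ᵉ blocks⇒h a₁≤ b₁≤)
                                (fromEmbedding hostEmb ∘ᵉ blocks⇒h a₂≤ b₂≤)))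
      where
      host∈ᶠH : host ∈ᶠ H
      host∈ᶠH = host , host∈H , isoRefl host

    h₂∈H̄ : h₂ ∈ᶠ HBar H
    h₂∈H̄ = h₂ , inj₁ (isoRefl h₂) , isoRefl h₂

    pairsA : base ⇒ (piece a₁≤ b₁≤ ⊔ piece a₂≤ b₂≤)
    pairsA = ⊔-map (piece-incl a₁≤ b₁≤) (piece-incl a₂≤ b₂≤)

    eA : apex base ⇒ apex (piece a₁≤ b₁≤ ⊔ piece a₂≤ b₂≤)
    eA = apex-map pairsA

    typeA : FinType
    typeA = (pieceType a₁ b₁ ⊎ᶠ pieceType a₂ b₂) ⊎ᶠ point

    coverA : StrictCover (HBar H) g
    coverA = strictCover (HBar H) {gType} {typeA} eA
      (apex-map-slimOnto pairsA (⊔-map-slimOnto (piece-incl a₁≤ b₁≤) (piece-incl a₂≤ b₂≤)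
                                                (piece-incl-slimOnto a₁≤ b₁≤) (piece-incl-slimOnto a₂≤ b₂≤)))
      (joinSum (HBar H) {pieceType a₁ b₁} {pieceType a₂ b₂} (piece-oneFat a₁≤ b₁≤) (piece-oneFat a₂≤ b₂≤)
               (piece∈H̄ a₁≤ b₁≤) (piece∈H̄ a₂≤ b₂≤) h₂∈H̄)

    crossed : ((innerBlock a₁≤ ⊔ outerBlock b₂≤) ⊔ (innerBlock a₂≤ ⊔ outerBlock b₁≤)) ⇒ (piece a₁≤ b₂≤ ⊔ piece a₂≤ b₁≤)
    crossed = ⊔-map (piece-incl a₁≤ b₂≤) (piece-incl a₂≤ b₁≤)

    pairsB : base ⇒ (piece a₁≤ b₂≤ ⊔ piece a₂≤ b₁≤)
    pairsB = crossed ∘ᵉ ⊔-interchange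

    eB : apex base ⇒ apex (piece a₁≤ b₂≤ ⊔ piece a₂≤ b₁≤)
    eB = apex-map pairsB

    typeB : FinType
    typeB = (pieceType a₁ b₂ ⊎ᶠ pieceType a₂ b₁) ⊎ᶠ point

    coverB : StrictCover (HBar H) g
    coverB = strictCover (HBar H) {gType} {typeB} eB
      (apex-map-slimOnto pairsB
        (∘ᵉ-slimOnto crossed ⊔-interchange
          (⊔-map-slimOnto (piece-incl a₁≤ b₂≤) (piece-incl a₂≤ b₁≤) (piece-incl-slimOnto a₁≤ b₂≤) (piece-incl-slimOnto a₂≤ b₁≤))
          (⊔-interchange-slimOnto {P = innerBlock a₁≤} {Q = outerBlock b₁≤} {R = innerBlock a₂≤} {S = outerBlock b₂≤})))
      (joinSum (HBar H) {pieceType a₁ b₂} {pieceType a₂ b₁} (piece-oneFat a₁≤ b₂≤) (piece-oneFat a₂≤ b₁≤)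
               (piece∈H̄ a₁≤ b₂≤) (piece∈H̄ a₂≤ b₁≤) h₂∈H̄)

    x₀ y₀ : Fin (n g)
    x₀ = encode gType (inj₁ (inj₁ (inj₁ zero)))
    y₀ = encode gType (inj₁ (inj₁ (inj₂ zero)))

    -- in cover A they lie in the same piece and share its fat vertex
    sharedInA : SharedInCover x₀ y₀ coverA
    sharedInA = realise-sharedFat {typeA} {apex (piece a₁≤ b₁≤ ⊔ piece a₂≤ b₂≤)} (emb (incl coverA) x₀) (emb (incl coverA) y₀)
      (subst₂ (SharedFat (apex (piece a₁≤ b₁≤ ⊔ piece a₂≤ b₂≤)))
              (≡.sym (Realise.decode-emb {gType} {typeA} eA (inj₁ (inj₁ (inj₁ zero)))))
              (≡.sym (Realise.decode-emb {gType} {typeA} eA (inj₁ (inj₁ (inj₂ zero)))))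
              (inj₁ (inj₁ (inj₂ tt)) , (refl , refl) , (refl , refl)))

    -- in cover B they lie in different pieces
    unsharedInB : ¬ SharedInCover x₀ y₀ coverB
    unsharedInB shared = join-noSharedFat {X = piece a₁≤ b₂≤} {Y = piece a₂≤ b₁≤} (inj₁ (inj₁ zero)) (inj₁ (inj₂ zero))
      (subst₂ (SharedFat (apex (piece a₁≤ b₂≤ ⊔ piece a₂≤ b₁≤)))
              (Realise.decode-emb {gType} {typeB} eB (inj₁ (inj₁ (inj₁ zero))))
              (Realise.decode-emb {gType} {typeB} eB (inj₁ (inj₁ (inj₂ zero))))
              (realise-sharedFat⁻ {typeB} {apex (piece a₁≤ b₂≤ ⊔ piece a₂≤ b₁≤)} (emb (incl coverB) x₀) (emb (incl coverB) y₀) shared))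

    noUniqueCover : ¬ UniqueStrictCover (HBar H) g
    noUniqueCover = notUnique x₀ y₀ coverA coverB sharedInA unsharedInB

    g-connected : Connected g
    g-connected = apex-connected baseType base

  noUniqueness : h₂ ∈ᶠ H → ∀ N → 5 ≤ N → N ≤ 2 * slimCount h + 1 → ¬ UniqueCoverProp H N
  noUniqueness h₂∈H N 5≤N N≤ unique = noUniqueCover (unique g g-line g-connected order)
    where
    open Blocks (blocks #in #out N 1≤#in 1≤#out 5≤N (subst (λ s → N ≤ 2 * s + 1) (≡.sym #in+#out) N≤))
    open Counterexample h₂∈H a₁≤ b₁≤ a₂≤ b₂≤

proposition5p2 : (H : Family) → (∀ g → H g → InO g) → h₂ ∈ᶠ H →
    (h : HGraph) → HBar H h → ¬ SlimConnected h →
    NH≥ H (2 * slimCount h + 2)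
proposition5p2 H H⊆O h₂∈H h h∈H̄ disconnected N 7≤N unique with 2 * slimCount h + 2 ≤? N
... | yes large = large
... | no small = ⊥-elim (noUniqueness h₂∈H N 5≤N N≤ unique)
  where
  open Construction (situation H H⊆O h h∈H̄ disconnected)
  5≤N : 5 ≤ N
  5≤N = ≤-trans (m≤m+n 5 2) 7≤N
  N≤ : N ≤ 2 * slimCount h + 1
  N≤ = ≤-pred (subst (suc N ≤_) (+-suc (2 * slimCount h) 1) (≰⇒> small))
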